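{- For any odd integer $n \ge 5$, the graph $G = \mathrm{Circ}(2n, \{1, n\}) \,\square\, K_4$ is a Cayley nut graph with $o_e(G) = 3$ and $o_a(G) = 3$.
   Context: All graphs are finite, simple and undirected. For $S \subseteq \{1, \ldots, \lfloor m/2 \rfloor\}$, $\mathrm{Circ}(m,S)$ is the graph on vertex set $\mathbb{Z}_m$ in which $u$ and $v$ are adjacent iff $u - v \in S$ or $v - u \in S$ (computed in $\mathbb{Z}_m$). $G \,\square\, H$ denotes the Cartesian product of graphs: vertex set $V(G)\times V(H)$, with $(g,h)\sim(g',h')$ iff ($g=g'$ and $h\sim h'$ in $H$) or ($h=h'$ and $g\sim g'$ in $G$). $K_4$ is the complete graph on four vertices. A nut graph is a graph with at least two vertices whose adjacency matrix has a one-dimensional null space spanned by a vector with no zero entries. For a graph $G$, $o_e(G)$ and $o_a(G)$ denote the number of orbits of $\mathrm{Aut}\,G$ on the edge set and on the arc set (ordered pairs of adjacent vertices), respectively. A Cayley graph is a graph of the form $\mathrm{Cay}(\Gamma,S)$ for a group $\Gamma$ and inverse-closed $S\subseteq\Gamma\setminus\{e\}$, with $g\sim h$ iff $g^{ -1}h\in S$. -}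

module Defs where

open import Level using (Level; 0ℓ) renaming (suc to lsuc)
open import Data.Nat as ℕ using (ℕ; zero; suc; _+_; _∸_; _≤ᵇ_; _≡ᵇ_)
open import Data.Bool using (Bool; true; false; if_then_else_; not; _∨_; _∧_)
open import Data.Fin as Fin using (Fin; toℕ; remQuot)
open import Data.Fin.Properties using (_≟_)
open import Data.List using (List; _∷_; [])
open import Data.Bool.ListAction using (any)
open import Data.Product using (Σ; ∃; _×_; _,_; proj₁; proj₂)
open import Data.Sum using (_⊎_)
open import Data.Rational as ℚ using (ℚ; 0ℚ; 1ℚ)
open import Relation.Binary.PropositionalEquality using (_≡_; _≢_)
open import Relation.Nullary.Decidable using (⌊_⌋)
open import Relation.Nullary using (¬_)
open import Algebra.Structures using (IsGroup)

-- Finite graphs on vertex set Fin N, adjacency given as a Boolean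
-- relation.  (All graphs built below are symmetric and loopless.)

record Graph : Set where
  field
    N     : ℕ
    adj   : Fin N → Fin N → Bool
open Graph public

Adj : (G : Graph) → Fin (N G) → Fin (N G) → Set
Adj G u v = adj G u v ≡ true

diffMod : (m : ℕ) → Fin m → Fin m → ℕ
diffMod m u v = if toℕ u ≤ᵇ toℕ v then toℕ v ∸ toℕ u else (m + toℕ v) ∸ toℕ u

circAdj : (m : ℕ) → List ℕ → Fin m → Fin m → Bool
circAdj m S u v = any (λ s → (diffMod m u v ≡ᵇ s) ∨ (diffMod m v u ≡ᵇ s)) S


completeAdj : (k : ℕ) → Fin k → Fin k → Bool
completeAdj k u v = not ⌊ u ≟ v ⌋

boxAdj : {a b : ℕ} → (Fin a → Fin a → Bool) → (Fin b → Fin b → Bool)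
       → Fin (a ℕ.* b) → Fin (a ℕ.* b) → Bool
boxAdj {a} {b} A B x y with remQuot {a} b x | remQuot {a} b y
... | (g , h) | (g' , h') =
  (⌊ g ≟ g' ⌋ ∧ B h h') ∨ (⌊ h ≟ h' ⌋ ∧ A g g')

sumFin : (k : ℕ) → (Fin k → ℚ) → ℚ
sumFin zero    f = 0ℚ
sumFin (suc k) f = f Fin.zero ℚ.+ sumFin k (λ i → f (Fin.suc i))

entry : Bool → ℚ
entry true  = 1ℚ
entry false = 0ℚ

adjMul : (G : Graph) → (Fin (N G) → ℚ) → Fin (N G) → ℚ
adjMul G x i = sumFin (N G) (λ j → entry (adj G i j) ℚ.* x j)

InNullSpace : (G : Graph) → (Fin (N G) → ℚ) → Set
InNullSpace G x = ∀ i → adjMul G x i ≡ 0ℚ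

IsNut : Graph → Set
IsNut G =
  2 ℕ.≤ N G ×
  Σ (Fin (N G) → ℚ) λ x →
      (∀ i → x i ≢ 0ℚ) ×
      InNullSpace G x ×
      (∀ y → InNullSpace G y → Σ ℚ λ c → ∀ i → y i ≡ c ℚ.* x i)

record Aut (G : Graph) : Set where
  field
    σ     : Fin (N G) → Fin (N G)
    σ⁻¹   : Fin (N G) → Fin (N G)
    left  : ∀ u → σ⁻¹ (σ u) ≡ u
    right : ∀ u → σ (σ⁻¹ u) ≡ u
    pres  : ∀ u v → adj G (σ u) (σ v) ≡ adj G u v
open Aut public

-- Arcs: ordered pairs of adjacent vertices.  An edge {u,v} is
-- represented by any arc (u,v); edge-equivalence allows swapping.
Arc : Graph → Set
Arc G = Σ (Fin (N G) × Fin (N G)) λ p → Adj G (proj₁ p) (proj₂ p)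

SameArcOrbit : (G : Graph) → Arc G → Arc G → Set
SameArcOrbit G ((u , v) , _) ((u' , v') , _) =
  Σ (Aut G) λ φ → (σ φ u ≡ u' × σ φ v ≡ v')

SameEdgeOrbit : (G : Graph) → Arc G → Arc G → Set
SameEdgeOrbit G ((u , v) , _) ((u' , v') , _) =
  Σ (Aut G) λ φ → (σ φ u ≡ u' × σ φ v ≡ v') ⊎ (σ φ u ≡ v' × σ φ v ≡ u')

NumClasses : (X : Set) → (X → X → Set) → ℕ → Set
NumClasses X R k =
  Σ (Fin k → X) λ r →
    (∀ i j → R (r i) (r j) → i ≡ j) ×
    (∀ x → Σ (Fin k) λ i → R x (r i))

ArcOrbits : Graph → ℕ → Set
ArcOrbits G k = NumClasses (Arc G) (SameArcOrbit G) k

EdgeOrbits : Graph → ℕ → Set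
EdgeOrbits G k = NumClasses (Arc G) (SameEdgeOrbit G) k

record CayleyData (G : Graph) : Set₁ where
  field
    C       : Set
    _∙_     : C → C → C
    e       : C
    _⁻¹     : C → C
    isGroup : IsGroup _≡_ _∙_ e _⁻¹
    S       : C → Set
    invClosed : ∀ g → S g → S (g ⁻¹)
    noUnit  : ¬ S e
    f       : Fin (N G) → C
    g       : C → Fin (N G)
    fg      : ∀ x → f (g x) ≡ x
    gf      : ∀ u → g (f u) ≡ u
    adjIff  : ∀ u v → (Adj G u v → S (((f u) ⁻¹) ∙ f v)) ×
                      (S (((f u) ⁻¹) ∙ f v) → Adj G u v)

IsCayley : Graph → Set₁
IsCayley G = CayleyData G

circ : (m : ℕ) → List ℕ → Graph
circ m S = record { N = m ; adj = circAdj m S }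

K : ℕ → Graph
K k = record { N = k ; adj = completeAdj k }

_□_ : Graph → Graph → Graph
G □ H = record { N = N G ℕ.* N H ; adj = boxAdj {N G} {N H} (adj G) (adj H) }

propGraph : ℕ → Graph
propGraph n = circ (2 ℕ.* n) (1 ∷ n ∷ []) □ K 4

-- The graph is the Cayley graph of ℤ₂ₙ × ℤ₄ with connection set {(±1,0), (n,0)} ∪ {(0,b) | b ≠ 0}.
-- Translations make it vertex-transitive, and since the group is abelian the point reflections
-- x ↦ u + v − x flip every edge, so o_e = o_a.  At a vertex, inversion and the permutations of the
-- K₄ factor leave three classes of arcs: rim (±1), rung (n) and K₄ edges.  They are distinct: only K₄
-- edges lie in triangles (the Möbius ladder Circ(2n, {1, n}) is bipartite for odd n), and a rung, unlike
-- a rim edge, closes a 4-cycle with every other triangle-free edge at its end (this needs n ≥ 5).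
--
-- For a null vector, with A the adjacency operator of the ladder, the differences of its K₄-layers
-- satisfy A d = d and the common layer then satisfies A z = −3 z.  Splitting a function into its parts
-- symmetric and antisymmetric under the half-turn g ↦ g + n turns both into eigen-equations of the
-- 2n-cycle C: for odd n, C has no eigenvalue 0 (its eigenvalue-0 functions change sign after n double
-- steps), eigenvalue 2 only on constants and −2 only on multiples of (−1)ᵍ (maximum principle), and
-- nothing beyond ±2.  So the kernel is spanned by (g, h) ↦ (−1)ᵍ, which has no zero entries.
module Submission where

open import Level using (0ℓ)
open import Algebra.Bundles using (AbelianGroup; Group; Ring)
open import Algebra.Structures using (IsAbelianGroup; IsGroup)
open import Data.Bool using (Bool; true; false; not; _∧_; _∨_; T)
open import Data.Bool.ListAction using (any; or)
open import Data.Bool.Properties using (∨-zeroʳ; ∧-zeroʳ; ∨-comm; ⇔→≡; T-≡)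
open import Data.Empty using (⊥-elim)
open import Data.Fin as Fin using (Fin; toℕ; fromℕ<; combine; remQuot)
open import Data.Fin.Patterns using (0F; 1F; 2F)
open import Data.Fin.Permutation as Perm using (Permutation′; _⟨$⟩ʳ_; _⟨$⟩ˡ_; transpose)
open import Data.Fin.Properties as FinP
  using (toℕ-injective; toℕ<n; toℕ-fromℕ<; _≟_; remQuot-combine; combine-remQuot; punchInᵢ≢i; punchIn-injective)
open import Data.List using (List; []; _∷_; allFin)
open import Data.List.Membership.Propositional.Properties using (∈-allFin)
open import Data.List.Properties using (map-cong)
open import Data.List.Relation.Unary.All as All using (All; []; _∷_)
open import Data.Nat as ℕ using (ℕ; zero; suc; _≤_; _<_; _%_; _/_; NonZero; _≤ᵇ_; _≡ᵇ_; z≤n; s≤s)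
open import Data.Nat.DivMod using (m≡m%n+[m/n]*n; m%n<n; m<n⇒m%n≡m; %-distribˡ-+; m%n%n≡m%n; [m+n]%n≡m%n)
open import Data.Nat.Divisibility using (_∣_; divides; ∣n⇒∣m*n)
import Data.Nat.Properties as ℕP
open import Data.Product as Product using (∃-syntax; _×_; _,_; proj₁; proj₂; uncurry)
open import Data.Rational as ℚ using (ℚ; 0ℚ; 1ℚ)
import Data.Rational.Properties as ℚP
open import Data.Sum using (_⊎_; inj₁; inj₂)
open import Function using (Injective; _⇔_; mk⇔; Equivalence; _∘_; case_of_)
open import Relation.Binary.Bundles using (DecTotalOrder)
open import Relation.Binary.PropositionalEquality
open import Relation.Nullary using (¬_; yes; no; ofʸ; ofⁿ)
open import Relation.Nullary.Decidable using (⌊_⌋; dec⇒maybe; from-yes)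
open import Tactic.RingSolver using (solve-∀)
open import Tactic.RingSolver.Core.AlmostCommutativeRing using (AlmostCommutativeRing; fromCommutativeRing)

open import Defs

-- ℤ/mℤ on Fin m

module Modular (m : ℕ) .{{_ : NonZero m}} where

  open import Data.Nat using (_+_; _∸_)

  ι : ℕ → Fin m
  ι x = fromℕ< (m%n<n x m)

  toℕ-ι : ∀ x → toℕ (ι x) ≡ x % m
  toℕ-ι x = toℕ-fromℕ< _

  ι-≡ : ∀ {x y} → x % m ≡ y % m → ι x ≡ ι y
  ι-≡ {x} {y} eq = toℕ-injective (trans (toℕ-ι x) (trans eq (sym (toℕ-ι y))))

  ι-toℕ : ∀ a → ι (toℕ a) ≡ a
  ι-toℕ a = toℕ-injective (trans (toℕ-ι (toℕ a)) (m<n⇒m%n≡m (toℕ<n a)))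

  ι-injective : ∀ {x y} → x < m → y < m → ι x ≡ ι y → x ≡ y
  ι-injective {x} {y} x<m y<m eq = begin
    x            ≡⟨ sym (m<n⇒m%n≡m x<m) ⟩
    x % m        ≡⟨ sym (toℕ-ι x) ⟩
    toℕ (ι x)    ≡⟨ cong toℕ eq ⟩
    toℕ (ι y)    ≡⟨ toℕ-ι y ⟩
    y % m        ≡⟨ m<n⇒m%n≡m y<m ⟩
    y            ∎
    where open ≡-Reasoning

  ι-+m : ∀ x → ι (x + m) ≡ ι x
  ι-+m x = ι-≡ ([m+n]%n≡m%n x m)

  infixl 6 _⊕_
  _⊕_ : Fin m → Fin m → Fin m
  a ⊕ b = ι (toℕ a + toℕ b)

  ⊖_ : Fin m → Fin m
  ⊖ a = ι (m ∸ toℕ a)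

  𝟘 : Fin m
  𝟘 = ι 0

  ι-+ : ∀ x y → ι (x + y) ≡ ι x ⊕ ι y
  ι-+ x y = ι-≡ (trans (%-distribˡ-+ x y m)
                       (sym (cong₂ (λ p q → (p + q) % m) (toℕ-ι x) (toℕ-ι y))))

  ι-⊕ : ∀ x a → ι x ⊕ a ≡ ι (x + toℕ a)
  ι-⊕ x a = ι-≡ (begin
    (toℕ (ι x) + toℕ a) % m  ≡⟨ cong (λ t → (t + toℕ a) % m) (toℕ-ι x) ⟩
    (x % m + toℕ a) % m      ≡⟨ %-distribˡ-+ (x % m) (toℕ a) m ⟩
    (x % m % m + toℕ a % m) % m ≡⟨ cong (λ t → (t + toℕ a % m) % m) (m%n%n≡m%n x m) ⟩
    (x % m + toℕ a % m) % m  ≡⟨ %-distribˡ-+ x (toℕ a) m ⟨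
    (x + toℕ a) % m          ∎)
    where open ≡-Reasoning

  ⊕-comm : ∀ a b → a ⊕ b ≡ b ⊕ a
  ⊕-comm a b = cong ι (ℕP.+-comm (toℕ a) (toℕ b))

  ⊕-assoc : ∀ a b c → (a ⊕ b) ⊕ c ≡ a ⊕ (b ⊕ c)
  ⊕-assoc a b c = begin
    ι (toℕ a + toℕ b) ⊕ c      ≡⟨ ι-⊕ (toℕ a + toℕ b) c ⟩
    ι (toℕ a + toℕ b + toℕ c)  ≡⟨ cong ι (ℕP.+-assoc (toℕ a) (toℕ b) (toℕ c)) ⟩
    ι (toℕ a + (toℕ b + toℕ c)) ≡⟨ cong ι (ℕP.+-comm (toℕ a) _) ⟩
    ι (toℕ b + toℕ c + toℕ a)  ≡⟨ ι-⊕ (toℕ b + toℕ c) a ⟨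
    (b ⊕ c) ⊕ a                ≡⟨ ⊕-comm (b ⊕ c) a ⟩
    a ⊕ (b ⊕ c)                ∎
    where open ≡-Reasoning

  ⊕-identityˡ : ∀ a → 𝟘 ⊕ a ≡ a
  ⊕-identityˡ a = trans (ι-⊕ 0 a) (ι-toℕ a)

  ⊖-inverseˡ : ∀ a → ⊖ a ⊕ a ≡ 𝟘
  ⊖-inverseˡ a = begin
    ι (m ∸ toℕ a) ⊕ a      ≡⟨ ι-⊕ (m ∸ toℕ a) a ⟩
    ι (m ∸ toℕ a + toℕ a)  ≡⟨ cong ι (ℕP.m∸n+n≡m (ℕP.<⇒≤ (toℕ<n a))) ⟩
    ι m                    ≡⟨ ι-+m 0 ⟩
    𝟘                      ∎
    where open ≡-Reasoning

  isAbelianGroup : IsAbelianGroup _≡_ _⊕_ 𝟘 ⊖_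
  isAbelianGroup = record
    { isGroup = record
      { isMonoid = record
        { isSemigroup = record
          { isMagma = record { isEquivalence = isEquivalence ; ∙-cong = cong₂ _⊕_ }
          ; assoc = ⊕-assoc }
        ; identity = ⊕-identityˡ , λ a → trans (⊕-comm a 𝟘) (⊕-identityˡ a) }
      ; inverse = ⊖-inverseˡ , λ a → trans (⊕-comm a (⊖ a)) (⊖-inverseˡ a)
      ; ⁻¹-cong = cong ⊖_ }
    ; comm = ⊕-comm }

  abelianGroup : AbelianGroup 0ℓ 0ℓ
  abelianGroup = record { isAbelianGroup = isAbelianGroup }

  open AbelianGroup abelianGroup public using (identityʳ; inverseʳ)
  open import Algebra.Properties.AbelianGroup abelianGroup public

  toℕ-𝟘 : toℕ 𝟘 ≡ 0
  toℕ-𝟘 = trans (toℕ-ι 0) (m<n⇒m%n≡m (ℕ.>-nonZero⁻¹ m))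

  ⊖⊕≡𝟘⇔ : ∀ {u v} → ⊖ u ⊕ v ≡ 𝟘 ⇔ u ≡ v
  ⊖⊕≡𝟘⇔ {u} {v} = mk⇔
    (λ q → sym (trans (sym (\\-leftDividesˡ u v)) (trans (cong (u ⊕_) q) (identityʳ u))))
    (λ { refl → ⊖-inverseˡ u })

  ⊖-swap : ∀ {w a} → ⊖ w ≡ a → w ≡ ⊖ a
  ⊖-swap {w} e = trans (sym (⁻¹-involutive w)) (cong ⊖_ e)

  diffMod-spec : ∀ u v → diffMod m u v < m × u ⊕ ι (diffMod m u v) ≡ v
  diffMod-spec u v with toℕ u ≤ᵇ toℕ v | ℕP.≤ᵇ-reflects-≤ (toℕ u) (toℕ v)
  ... | true | ofʸ u≤v =
        ℕP.≤-<-trans (ℕP.m∸n≤m (toℕ v) (toℕ u)) (toℕ<n v)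
      , (begin
          u ⊕ ι (toℕ v ∸ toℕ u)          ≡⟨ ⊕-comm u _ ⟩
          ι (toℕ v ∸ toℕ u) ⊕ u          ≡⟨ ι-⊕ _ u ⟩
          ι (toℕ v ∸ toℕ u + toℕ u)      ≡⟨ cong ι (ℕP.m∸n+n≡m u≤v) ⟩
          ι (toℕ v)                      ≡⟨ ι-toℕ v ⟩
          v                              ∎)
    where open ≡-Reasoning
  ... | false | ofⁿ u≰v =
        subst (m + toℕ v ∸ toℕ u <_) (ℕP.m+n∸n≡m m (toℕ u))
              (ℕP.∸-monoˡ-< (ℕP.+-monoʳ-< m v<u) u≤m+v)
      , (begin
          u ⊕ ι (m + toℕ v ∸ toℕ u)      ≡⟨ ⊕-comm u _ ⟩
          ι (m + toℕ v ∸ toℕ u) ⊕ u      ≡⟨ ι-⊕ _ u ⟩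
          ι (m + toℕ v ∸ toℕ u + toℕ u)  ≡⟨ cong ι (ℕP.m∸n+n≡m u≤m+v) ⟩
          ι (m + toℕ v)                  ≡⟨ cong ι (ℕP.+-comm m (toℕ v)) ⟩
          ι (toℕ v + m)                  ≡⟨ ι-+m (toℕ v) ⟩
          ι (toℕ v)                      ≡⟨ ι-toℕ v ⟩
          v                              ∎)
    where
    open ≡-Reasoning
    v<u : toℕ v < toℕ u
    v<u = ℕP.≰⇒> u≰v
    u≤m+v : toℕ u ≤ m + toℕ v
    u≤m+v = ℕP.≤-trans (ℕP.<⇒≤ (toℕ<n u)) (ℕP.m≤m+n m (toℕ v))

  diffMod-≡ : ∀ u v → diffMod m u v ≡ toℕ (⊖ u ⊕ v)
  diffMod-≡ u v = let d<m , u⊕d≡v = diffMod-spec u v in begin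
    diffMod m u v           ≡⟨ m<n⇒m%n≡m d<m ⟨
    diffMod m u v % m       ≡⟨ toℕ-ι _ ⟨
    toℕ (ι (diffMod m u v)) ≡⟨ cong toℕ (y≈x\\z u _ v u⊕d≡v) ⟩
    toℕ (⊖ u ⊕ v)           ∎
    where open ≡-Reasoning

-- Rational arithmetic and the sign (−1)ᵏ

open import Data.Rational using (_+_; _*_; -_; _-_)
open import Algebra.Properties.AbelianGroup ℚP.+-0-abelianGroup using ()
  renaming (⁻¹-involutive to neg-involutive; inverseˡ-unique to x+y≡0⇒x≡-y)
open import Algebra.Properties.Semiring.Sum (Ring.semiring ℚP.+-*-ring)
  using (sum; sum-cong-≗; sum-replicate-zero; ∑-distrib-+; *-distribˡ-sum)
open import Data.List.Extrema (DecTotalOrder.totalOrder ℚP.≤-decTotalOrder) using (argmax; f[xs]≤f[argmax])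

ℚ-ring : AlmostCommutativeRing 0ℓ 0ℓ
ℚ-ring = fromCommutativeRing ℚP.+-*-commutativeRing (λ x → dec⇒maybe (0ℚ ℚP.≟ x))

x*-1≡-x : ∀ x → x * - 1ℚ ≡ - x
x*-1≡-x = solve-∀ ℚ-ring

2*x≡x+x : ∀ x → (1ℚ + 1ℚ) * x ≡ x + x
2*x≡x+x = solve-∀ ℚ-ring

½*2* : ∀ x → ℚ.½ * ((1ℚ + 1ℚ) * x) ≡ x
½*2* x = trans (sym (ℚP.*-assoc ℚ.½ (1ℚ + 1ℚ) x)) (ℚP.*-identityˡ x)

x≡-x⇒x≡0 : ∀ x → x ≡ - x → x ≡ 0ℚ
x≡-x⇒x≡0 x x≡-x = begin
  x                    ≡⟨ ½*2* x ⟨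
  ℚ.½ * ((1ℚ + 1ℚ) * x) ≡⟨ cong (ℚ.½ *_) (2*x≡x+x x) ⟩
  ℚ.½ * (x + x)        ≡⟨ cong (λ y → ℚ.½ * (x + y)) x≡-x ⟩
  ℚ.½ * (x + - x)      ≡⟨ cong (ℚ.½ *_) (ℚP.+-inverseʳ x) ⟩
  ℚ.½ * 0ℚ             ≡⟨ ℚP.*-zeroʳ ℚ.½ ⟩
  0ℚ                   ∎
  where open ≡-Reasoning

sign : ℕ → ℚ
sign zero    = 1ℚ
sign (suc k) = - sign k

sign-+ : ∀ j k → sign (j ℕ.+ k) ≡ sign j * sign k
sign-+ zero    k = sym (ℚP.*-identityˡ (sign k))
sign-+ (suc j) k = trans (cong -_ (sign-+ j k)) (ℚP.neg-distribˡ-* (sign j) (sign k))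

sign≢0 : ∀ k → sign k ≢ 0ℚ
sign≢0 zero    ()
sign≢0 (suc k) eq = sign≢0 k (ℚP.neg-injective eq)

sign² : ∀ k → sign k * sign k ≡ 1ℚ
sign² zero    = refl
sign² (suc k) = trans (neg*neg (sign k) (sign k)) (sign² k)
  where
  neg*neg : ∀ x y → - x * - y ≡ x * y
  neg*neg = solve-∀ ℚ-ring

sign-*2 : ∀ j → sign (j ℕ.* 2) ≡ 1ℚ
sign-*2 zero    = refl
sign-*2 (suc j) = trans (neg-involutive (sign (j ℕ.* 2))) (sign-*2 j)

sign-even : ∀ {m} → 2 ∣ m → sign m ≡ 1ℚ
sign-even (divides q refl) = sign-*2 q

sign-% : ∀ {m} .{{_ : NonZero m}} x → 2 ∣ m → sign (x % m) ≡ sign x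
sign-% {m} x 2∣m = begin
  sign (x % m)                       ≡⟨ ℚP.*-identityʳ _ ⟨
  sign (x % m) * 1ℚ                  ≡⟨ cong (sign (x % m) *_) (sign-even (∣n⇒∣m*n (x / m) 2∣m)) ⟨
  sign (x % m) * sign (x / m ℕ.* m)  ≡⟨ sign-+ (x % m) _ ⟨
  sign (x % m ℕ.+ x / m ℕ.* m)       ≡⟨ cong sign (m≡m%n+[m/n]*n x m) ⟨
  sign x                             ∎
  where open ≡-Reasoning

sign-odd : ∀ n → n % 2 ≡ 1 → sign n ≡ - 1ℚ
sign-odd n n%2≡1 = begin
  sign n                             ≡⟨ cong sign (m≡m%n+[m/n]*n n 2) ⟩
  sign (n % 2 ℕ.+ n / 2 ℕ.* 2)       ≡⟨ sign-+ (n % 2) _ ⟩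
  sign (n % 2) * sign (n / 2 ℕ.* 2)  ≡⟨ cong₂ _*_ (cong sign n%2≡1) (sign-*2 (n / 2)) ⟩
  - 1ℚ * 1ℚ                          ≡⟨ ℚP.*-identityʳ _ ⟩
  - 1ℚ                               ∎
  where open ≡-Reasoning

module _ {m : ℕ} .{{_ : NonZero m}} (2∣m : 2 ∣ m) where

  open Modular m

  sign-⊕ : ∀ a b → sign (toℕ (a ⊕ b)) ≡ sign (toℕ a) * sign (toℕ b)
  sign-⊕ a b = begin
    sign (toℕ (a ⊕ b))             ≡⟨ cong sign (toℕ-ι _) ⟩
    sign ((toℕ a ℕ.+ toℕ b) % m)   ≡⟨ sign-% _ 2∣m ⟩
    sign (toℕ a ℕ.+ toℕ b)         ≡⟨ sign-+ (toℕ a) (toℕ b) ⟩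
    sign (toℕ a) * sign (toℕ b)    ∎
    where open ≡-Reasoning

  sign-⊖ : ∀ a → sign (toℕ (⊖ a)) ≡ sign (toℕ a)
  sign-⊖ a = begin
    sign (toℕ (⊖ a))                                  ≡⟨ ℚP.*-identityʳ _ ⟨
    sign (toℕ (⊖ a)) * 1ℚ                             ≡⟨ cong (sign (toℕ (⊖ a)) *_) (sign² (toℕ a)) ⟨
    sign (toℕ (⊖ a)) * (sign (toℕ a) * sign (toℕ a))  ≡⟨ ℚP.*-assoc (sign (toℕ (⊖ a))) _ _ ⟨
    sign (toℕ (⊖ a)) * sign (toℕ a) * sign (toℕ a)    ≡⟨ cong (_* sign (toℕ a)) (sign-⊕ (⊖ a) a) ⟨
    sign (toℕ (⊖ a ⊕ a)) * sign (toℕ a)               ≡⟨ cong (λ x → sign (toℕ x) * sign (toℕ a)) (⊖-inverseˡ a) ⟩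
    sign (toℕ 𝟘) * sign (toℕ a)                       ≡⟨ cong (λ x → sign x * sign (toℕ a)) toℕ-𝟘 ⟩
    1ℚ * sign (toℕ a)                                 ≡⟨ ℚP.*-identityˡ _ ⟩
    sign (toℕ a)                                      ∎
    where open ≡-Reasoning

false≢true : false ≢ true
false≢true ()

∨-true⁻ : ∀ a b → a ∨ b ≡ true → a ≡ true ⊎ b ≡ true
∨-true⁻ true  _ _ = inj₁ refl
∨-true⁻ false _ e = inj₂ e

∨-trueˡ : ∀ a b → a ≡ true → a ∨ b ≡ true
∨-trueˡ _ _ refl = refl

∨-trueʳ : ∀ a b → b ≡ true → a ∨ b ≡ true
∨-trueʳ a _ refl = ∨-zeroʳ a

∧-true : ∀ {a b} → a ∧ b ≡ true → a ≡ true × b ≡ true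
∧-true {true} {true} _ = refl , refl

∧-∨-true : ∀ a b {c d} → (a ∧ b) ∨ (c ∧ d) ≡ true → (a ≡ true × b ≡ true) ⊎ (c ≡ true × d ≡ true)
∧-∨-true true  true  _ = inj₁ (refl , refl)
∧-∨-true true  false e = inj₂ (∧-true e)
∧-∨-true false _     e = inj₂ (∧-true e)

module _ {k : ℕ} where

  ⌊≟⌋-true : {u v : Fin k} → ⌊ u ≟ v ⌋ ≡ true → u ≡ v
  ⌊≟⌋-true {u} {v} e with u ≟ v
  ... | yes u≡v = u≡v

  ⌊≟⌋-refl : (u : Fin k) → ⌊ u ≟ u ⌋ ≡ true
  ⌊≟⌋-refl u with u ≟ u
  ... | yes _   = refl
  ... | no u≢u = ⊥-elim (u≢u refl)

  ⌊≟⌋-injective : ∀ {l} {f : Fin k → Fin l} → Injective _≡_ _≡_ f → ∀ u v → ⌊ f u ≟ f v ⌋ ≡ ⌊ u ≟ v ⌋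
  ⌊≟⌋-injective {f = f} inj u v with u ≟ v | f u ≟ f v
  ... | yes _   | yes _    = refl
  ... | yes refl | no fu≢fu = ⊥-elim (fu≢fu refl)
  ... | no u≢v  | yes fu≡fv = ⊥-elim (u≢v (inj fu≡fv))
  ... | no _    | no _     = refl

sumFin≡sum : ∀ k (f : Fin k → ℚ) → sumFin k f ≡ sum f
sumFin≡sum zero    f = refl
sumFin≡sum (suc k) f = cong (f Fin.zero +_) (sumFin≡sum k (λ i → f (Fin.suc i)))

δ : ∀ {k} → Fin k → Fin k → ℚ
δ i j = entry ⌊ i ≟ j ⌋

δ-self : ∀ {k} (i : Fin k) → δ i i ≡ 1ℚ
δ-self i = cong entry (⌊≟⌋-refl i)

δ-≢ : ∀ {k} {i j : Fin k} → i ≢ j → δ i j ≡ 0ℚ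
δ-≢ {i = i} {j} i≢j with i ≟ j
... | yes i≡j = ⊥-elim (i≢j i≡j)
... | no _    = refl

δ-suc : ∀ {k} (i j : Fin k) → δ (Fin.suc i) (Fin.suc j) ≡ δ i j
δ-suc i j with i ≟ j
... | yes _ = refl
... | no _  = refl

∑-δ : ∀ {k} (i : Fin k) (f : Fin k → ℚ) → sum (λ j → δ i j * f j) ≡ f i
∑-δ {suc k} Fin.zero f = begin
  1ℚ * f Fin.zero + sum {k} (λ j → 0ℚ * f (Fin.suc j))
    ≡⟨ cong₂ _+_ (ℚP.*-identityˡ (f Fin.zero)) (sum-cong-≗ {k} (λ j → ℚP.*-zeroˡ (f (Fin.suc j)))) ⟩
  f Fin.zero + sum {k} (λ _ → 0ℚ)  ≡⟨ cong (f Fin.zero +_) (sum-replicate-zero k) ⟩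
  f Fin.zero + 0ℚ                  ≡⟨ ℚP.+-identityʳ _ ⟩
  f Fin.zero                       ∎
  where open ≡-Reasoning
∑-δ {suc k} (Fin.suc i) f =
  trans (cong₂ _+_ (ℚP.*-zeroˡ (f Fin.zero))
                   (trans (sum-cong-≗ (λ j → cong (_* f (Fin.suc j)) (δ-suc i j))) (∑-δ i (λ j → f (Fin.suc j)))))
        (ℚP.+-identityˡ (f (Fin.suc i)))

∑-↑ : ∀ p q (f : Fin (p ℕ.+ q) → ℚ) →
      sum f ≡ sum (λ i → f (i Fin.↑ˡ q)) + sum (λ j → f (p Fin.↑ʳ j))
∑-↑ zero    q f = sym (ℚP.+-identityˡ _)
∑-↑ (suc p) q f = trans (cong (f Fin.zero +_) (∑-↑ p q (λ i → f (Fin.suc i))))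
  (sym (ℚP.+-assoc (f Fin.zero) (sum (λ i → f (Fin.suc i Fin.↑ˡ q))) (sum (λ j → f (suc p Fin.↑ʳ j)))))

∑-combine : ∀ a b (f : Fin (a ℕ.* b) → ℚ) → sum f ≡ sum {a} (λ i → sum {b} (λ j → f (combine i j)))
∑-combine zero    b f = refl
∑-combine (suc a) b f = begin
  sum f
    ≡⟨ ∑-↑ b (a ℕ.* b) f ⟩
  sum (λ j → f (j Fin.↑ˡ a ℕ.* b)) + sum (λ x → f (b Fin.↑ʳ x))
    ≡⟨ cong (sum (λ j → f (j Fin.↑ˡ a ℕ.* b)) +_) (∑-combine a b (λ x → f (b Fin.↑ʳ x))) ⟩
  sum {suc a} (λ i → sum {b} (λ j → f (combine i j)))
    ∎
  where open ≡-Reasoning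

-- Automorphisms, invariants and orbits

module _ {G : Graph} where

  private
    V = Fin (N G)

  idᴬ : Aut G
  idᴬ = record
    { σ = λ u → u ; σ⁻¹ = λ u → u ; left = λ _ → refl ; right = λ _ → refl ; pres = λ _ _ → refl }

  infixr 9 _∘ᴬ_
  _∘ᴬ_ : Aut G → Aut G → Aut G
  ψ ∘ᴬ φ = record
    { σ     = λ u → σ ψ (σ φ u)
    ; σ⁻¹   = λ u → σ⁻¹ φ (σ⁻¹ ψ u)
    ; left  = λ u → trans (cong (σ⁻¹ φ) (left ψ (σ φ u))) (left φ u)
    ; right = λ u → trans (cong (σ ψ) (right φ (σ⁻¹ ψ u))) (right ψ u)
    ; pres  = λ u v → trans (pres ψ (σ φ u) (σ φ v)) (pres φ u v)
    }

  _⁻¹ᴬ : Aut G → Aut G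
  φ ⁻¹ᴬ = record
    { σ = σ⁻¹ φ ; σ⁻¹ = σ φ ; left = right φ ; right = left φ
    ; pres = λ u v → trans (sym (pres φ (σ⁻¹ φ u) (σ⁻¹ φ v))) (cong₂ (adj G) (right φ u) (right φ v))
    }

  σ-injective : (φ : Aut G) → Injective _≡_ _≡_ (σ φ)
  σ-injective φ {u} {v} e = trans (sym (left φ u)) (trans (cong (σ⁻¹ φ) e) (left φ v))

  Adj-pres : (φ : Aut G) {u v : V} → Adj G u v → Adj G (σ φ u) (σ φ v)
  Adj-pres φ {u} {v} p = trans (pres φ u v) p

  InTriangle : V → V → Set
  InTriangle u v = ∃[ w ] Adj G u w × Adj G v w

  Invariant : (V → V → Set) → Set
  Invariant P = ∀ (φ : Aut G) {u v} → P u v → P (σ φ u) (σ φ v)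

  InTriangle-invariant : Invariant InTriangle
  InTriangle-invariant φ (w , uw , vw) = σ φ w , Adj-pres φ uw , Adj-pres φ vw

  invariant-⇔ : ∀ {P} → Invariant P → ∀ (φ : Aut G) {u v u' v'} →
                σ φ u ≡ u' → σ φ v ≡ v' → P u v ⇔ P u' v'
  invariant-⇔ {P} inv φ {u} {v} refl refl = mk⇔ (inv φ)
    (λ p → subst₂ P (left φ u) (left φ v) (inv (φ ⁻¹ᴬ) p))

  alternating⇒triangle-free : (s : V → ℚ) → (∀ u → s u ≢ 0ℚ) → (∀ u v → Adj G u v → s v ≡ - s u) →
                              ∀ u v → Adj G u v → ¬ InTriangle u v
  alternating⇒triangle-free s s≢0 flips u v uv (w , uw , vw) = s≢0 u (x≡-x⇒x≡0 (s u) (begin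
    s u          ≡⟨ neg-involutive (s u) ⟨
    - (- s u)    ≡⟨ cong -_ (trans (sym (flips u w uw)) (flips v w vw)) ⟩
    - (- s v)    ≡⟨ neg-involutive (s v) ⟩
    s v          ≡⟨ flips u v uv ⟩
    - s u        ∎))
    where open ≡-Reasoning

  -- Separates the rungs of the Möbius ladder from its rim edges.
  ClosesSquares : V → V → Set
  ClosesSquares u v = ∀ a → Adj G u a → ¬ InTriangle u a → a ≢ v → ∃[ b ] Adj G a b × Adj G b v × b ≢ u

  ClosesSquares-invariant : Invariant ClosesSquares
  ClosesSquares-invariant φ {u} {v} squares a′ ua′ ¬tri a′≢v =
    let b , ab , bv , b≢u = squares a ua ¬tri′ (λ a≡v → a′≢v (trans (sym σa≡a′) (cong (σ φ) a≡v)))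
    in σ φ b , subst (λ x → Adj G x (σ φ b)) σa≡a′ (Adj-pres φ ab) , Adj-pres φ bv , b≢u ∘ σ-injective φ
    where
    a : V
    a = σ⁻¹ φ a′
    σa≡a′ : σ φ a ≡ a′
    σa≡a′ = right φ a′
    ua : Adj G u a
    ua = trans (sym (pres φ u a)) (subst (Adj G (σ φ u)) (sym σa≡a′) ua′)
    ¬tri′ : ¬ InTriangle u a
    ¬tri′ t = ¬tri (subst (InTriangle (σ φ u)) σa≡a′ (InTriangle-invariant φ t))

  SameArcOrbit-∘ : ∀ {u v u' v' u'' v''} (φ ψ : Aut G) →
                   σ φ u ≡ u' → σ φ v ≡ v' → σ ψ u' ≡ u'' → σ ψ v' ≡ v'' →
                   σ (ψ ∘ᴬ φ) u ≡ u'' × σ (ψ ∘ᴬ φ) v ≡ v''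
  SameArcOrbit-∘ φ ψ refl refl refl refl = refl , refl

  arc-cover : ∀ {k} (r : Fin k → Arc G) (x₀ : V) →
              (∀ x → ∃[ φ ] σ φ x ≡ x₀) →
              (∀ y (p : Adj G x₀ y) → ∃[ i ] SameArcOrbit G ((x₀ , y) , p) (r i)) →
              ∀ a → ∃[ i ] SameArcOrbit G a (r i)
  arc-cover r x₀ transitive at-x₀ ((x , y) , p) =
    let φ , φx≡x₀ = transitive x
        i , ψ , e₁ , e₂ = at-x₀ (σ φ y) (subst (λ z → Adj G z (σ φ y)) φx≡x₀ (Adj-pres φ p))
    in i , ψ ∘ᴬ φ , SameArcOrbit-∘ φ ψ φx≡x₀ refl e₁ e₂

  arcOrbits⇒edgeOrbits : ∀ {k} → (∀ u v → Adj G u v → ∃[ ρ ] σ ρ u ≡ v × σ ρ v ≡ u) →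
                         ArcOrbits G k → EdgeOrbits G k
  arcOrbits⇒edgeOrbits flip (r , distinct , cover) = r , distinct′ , cover′
    where
    distinct′ : ∀ i j → SameEdgeOrbit G (r i) (r j) → i ≡ j
    distinct′ i j (φ , inj₁ e) = distinct i j (φ , e)
    distinct′ i j (φ , inj₂ (e₁ , e₂)) with r j | distinct i j
    ... | (u' , v') , q | distinct-ij =
      let ρ , ρu'≡v' , ρv'≡u' = flip u' v' q
      in distinct-ij (ρ ∘ᴬ φ , SameArcOrbit-∘ φ ρ e₁ e₂ ρv'≡u' ρu'≡v')
    cover′ : ∀ a → ∃[ i ] SameEdgeOrbit G a (r i)
    cover′ a = let i , φ , e = cover a in i , φ , inj₁ e

-- Complete graphs

K-aut : ∀ {k} → Permutation′ k → Aut (K k)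
K-aut π = record
  { σ = π ⟨$⟩ʳ_ ; σ⁻¹ = π ⟨$⟩ˡ_ ; left = λ _ → Perm.inverseˡ π ; right = λ _ → Perm.inverseʳ π
  ; pres = λ u v → cong not (⌊≟⌋-injective (σ-injective′ π) u v)
  }
  where
  σ-injective′ : ∀ {k} (π : Permutation′ k) → Injective _≡_ _≡_ (π ⟨$⟩ʳ_)
  σ-injective′ π {u} {v} e = trans (sym (Perm.inverseˡ π)) (trans (cong (π ⟨$⟩ˡ_) e) (Perm.inverseˡ π))

K-loopless : ∀ {k} (h : Fin k) → adj (K k) h h ≡ false
K-loopless h = cong not (⌊≟⌋-refl h)

Adj-K⇒≢ : ∀ {k} {u v : Fin k} → Adj (K k) u v → u ≢ v
Adj-K⇒≢ {u = u} p refl = false≢true (trans (cong not (sym (⌊≟⌋-refl u))) p)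

≢⇒Adj-K : ∀ {k} {u v : Fin k} → u ≢ v → Adj (K k) u v
≢⇒Adj-K {u = u} {v} u≢v with u ≟ v
... | yes u≡v = ⊥-elim (u≢v u≡v)
... | no _    = refl

K-triangle : ∀ {k} {h h' : Fin (suc (suc (suc k)))} → h ≢ h' → InTriangle {K _} h h'
K-triangle {k} {h} {h'} h≢h' = l , ≢⇒Adj-K (punchInᵢ≢i h l′ ∘ sym) , ≢⇒Adj-K (l≢h' ∘ sym)
  where
  -- h' = punchIn h j, so l = punchIn h (punchIn j 0) avoids both h and h'.
  j : Fin (suc (suc k))
  j = Fin.punchOut h≢h'
  l′ : Fin (suc (suc k))
  l′ = Fin.punchIn j Fin.zero
  l : Fin (suc (suc (suc k)))
  l = Fin.punchIn h l′
  l≢h' : l ≢ h'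
  l≢h' l≡h' = punchInᵢ≢i j Fin.zero (punchIn-injective h _ _ (trans l≡h' (sym (FinP.punchIn-punchOut h≢h'))))

module _ {k : ℕ} {i j : Fin k} where

  transpose-fixes : ∀ {l} → l ≢ i → l ≢ j → transpose i j ⟨$⟩ʳ l ≡ l
  transpose-fixes {l} l≢i l≢j with l ≟ i
  ... | yes l≡i = ⊥-elim (l≢i l≡i)
  ... | no _ with l ≟ j
  ...   | yes l≡j = ⊥-elim (l≢j l≡j)
  ...   | no _    = refl

  transpose-maps : transpose i j ⟨$⟩ʳ i ≡ j
  transpose-maps with i ≟ i
  ... | yes _   = refl
  ... | no i≢i = ⊥-elim (i≢i refl)

adjMul-K : ∀ {k} (y : Fin k → ℚ) h → adjMul (K k) y h ≡ sum y - y h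
adjMul-K y h = begin
  adjMul (K _) y h                             ≡⟨ sumFin≡sum _ (λ h' → entry (not ⌊ h ≟ h' ⌋) * y h') ⟩
  sum (λ h' → entry (not ⌊ h ≟ h' ⌋) * y h')  ≡⟨ sum-cong-≗ (λ h' → entry-not ⌊ h ≟ h' ⌋ (y h')) ⟩
  sum (λ h' → y h' + - 1ℚ * (δ h h' * y h'))  ≡⟨ ∑-distrib-+ y (λ h' → - 1ℚ * (δ h h' * y h')) ⟩
  sum y + sum (λ h' → - 1ℚ * (δ h h' * y h'))
    ≡⟨ cong (sum y +_) (*-distribˡ-sum (- 1ℚ) (λ h' → δ h h' * y h')) ⟨
  sum y + - 1ℚ * sum (λ h' → δ h h' * y h')   ≡⟨ cong (λ z → sum y + - 1ℚ * z) (∑-δ h y) ⟩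
  sum y + - 1ℚ * y h                          ≡⟨ minus (sum y) (y h) ⟩
  sum y - y h                                  ∎
  where
  open ≡-Reasoning
  minus : ∀ s z → s + - 1ℚ * z ≡ s - z
  minus = solve-∀ ℚ-ring
  entry-not : ∀ b z → entry (not b) * z ≡ z + - 1ℚ * (entry b * z)
  entry-not true  = solve-∀ ℚ-ring
  entry-not false = solve-∀ ℚ-ring

-- Cartesian products

entry-∧ : ∀ a b → entry (a ∧ b) ≡ entry a * entry b
entry-∧ true  true  = refl
entry-∧ true  false = refl
entry-∧ false true  = refl
entry-∧ false false = refl

entry-∨-disjoint : ∀ a b → (a ≡ true → b ≡ false) → entry (a ∨ b) ≡ entry a + entry b
entry-∨-disjoint true  _ a→¬b rewrite a→¬b refl = refl
entry-∨-disjoint false b _ = sym (ℚP.+-identityˡ (entry b))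

module _ {G H : Graph} where

  private
    V = Fin (N G ℕ.* N H)

  □adj : Fin (N G) × Fin (N H) → Fin (N G) × Fin (N H) → Bool
  □adj (g , h) (g' , h') = (⌊ g ≟ g' ⌋ ∧ adj H h h') ∨ (⌊ h ≟ h' ⌋ ∧ adj G g g')

  adj-□ : ∀ u v → adj (G □ H) u v ≡ □adj (remQuot (N H) u) (remQuot (N H) v)
  adj-□ u v with remQuot {N G} (N H) u | remQuot {N G} (N H) v
  ... | _ | _ = refl

  adj-□-combine : ∀ g h g' h' → adj (G □ H) (combine g h) (combine g' h') ≡
                  (⌊ g ≟ g' ⌋ ∧ adj H h h') ∨ (⌊ h ≟ h' ⌋ ∧ adj G g g')
  adj-□-combine g h g' h' = trans (adj-□ _ _) (cong₂ □adj (remQuot-combine g h) (remQuot-combine g' h'))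

  □adj-true⇔ : ∀ {g h g' h'} →
               □adj (g , h) (g' , h') ≡ true ⇔ ((g ≡ g' × Adj H h h') ⊎ (h ≡ h' × Adj G g g'))
  □adj-true⇔ {g} {h} {g'} {h'} = mk⇔ to from
    where
    to : □adj (g , h) (g' , h') ≡ true → (g ≡ g' × Adj H h h') ⊎ (h ≡ h' × Adj G g g')
    to p with ∧-∨-true ⌊ g ≟ g' ⌋ (adj H h h') p
    ... | inj₁ (g≡g' , q) = inj₁ (⌊≟⌋-true g≡g' , q)
    ... | inj₂ (h≡h' , q) = inj₂ (⌊≟⌋-true h≡h' , q)
    from : (g ≡ g' × Adj H h h') ⊎ (h ≡ h' × Adj G g g') → □adj (g , h) (g' , h') ≡ true
    from (inj₁ (refl , q)) rewrite ⌊≟⌋-refl g | q = refl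
    from (inj₂ (refl , q)) rewrite ⌊≟⌋-refl h | q = ∨-zeroʳ _

  Adj-□⇔ : ∀ {g h g' h'} →
           Adj (G □ H) (combine g h) (combine g' h') ⇔ ((g ≡ g' × Adj H h h') ⊎ (h ≡ h' × Adj G g g'))
  Adj-□⇔ {g} {h} {g'} {h'} = subst (λ b → (b ≡ true) ⇔ ((g ≡ g' × Adj H h h') ⊎ (h ≡ h' × Adj G g g')))
                                   (sym (adj-□-combine g h g' h')) □adj-true⇔

  Adj-□ᴴ : ∀ g {h h'} → Adj H h h' → Adj (G □ H) (combine g h) (combine g h')
  Adj-□ᴴ g {h} {h'} p = Equivalence.from (Adj-□⇔ {g} {h} {g} {h'}) (inj₁ (refl , p))

  Adj-□ᴳ : ∀ {g g'} h → Adj G g g' → Adj (G □ H) (combine g h) (combine g' h)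
  Adj-□ᴳ {g} {g'} h p = Equivalence.from (Adj-□⇔ {g} {h} {g'} {h}) (inj₂ (refl , p))

  combine-elim : (P : V → Set) → (∀ g h → P (combine g h)) → ∀ x → P x
  combine-elim P p x = subst P (combine-remQuot {N G} (N H) x) (uncurry p (remQuot {N G} (N H) x))

  □-common-neighbour : (∀ h → adj H h h ≡ false) → ∀ {g g' h} → g ≢ g' → ∀ x →
                       Adj (G □ H) (combine g h) x → Adj (G □ H) (combine g' h) x →
                       ∃[ a ] x ≡ combine a h × Adj G g a × Adj G g' a
  □-common-neighbour loopless {g} {g'} {h} g≢g' = combine-elim
    (λ x → Adj (G □ H) (combine g h) x → Adj (G □ H) (combine g' h) x →
           ∃[ a ] x ≡ combine a h × Adj G g a × Adj G g' a)
    (λ a b p q → cases (Equivalence.to (Adj-□⇔ {g} {h} {a} {b}) p) (Equivalence.to (Adj-□⇔ {g'} {h} {a} {b}) q))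
    where
    cases : ∀ {a b} → (g ≡ a × Adj H h b) ⊎ (h ≡ b × Adj G g a) → (g' ≡ a × Adj H h b) ⊎ (h ≡ b × Adj G g' a) →
            ∃[ a′ ] combine a b ≡ combine a′ h × Adj G g a′ × Adj G g' a′
    cases (inj₁ (refl , _))  (inj₁ (refl , _))   = ⊥-elim (g≢g' refl)
    cases (inj₁ (_ , hb))    (inj₂ (refl , _))   = ⊥-elim (false≢true (trans (sym (loopless h)) hb))
    cases (inj₂ (refl , _))  (inj₁ (_ , hb))     = ⊥-elim (false≢true (trans (sym (loopless h)) hb))
    cases {a} (inj₂ (refl , ga)) (inj₂ (_ , g'a)) = a , refl , ga , g'a

  □-triangleᴳ : (∀ h → adj H h h ≡ false) → (∀ g → adj G g g ≡ false) → ∀ {g g'} h → Adj G g g' →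
                InTriangle {G □ H} (combine g h) (combine g' h) → InTriangle {G} g g'
  □-triangleᴳ loopless-H loopless-G {g} {g'} h gg' (x , p , q) =
    let a , _ , ga , g'a = □-common-neighbour loopless-H g≢g' x p q in a , ga , g'a
    where
    g≢g' : g ≢ g'
    g≢g' refl = false≢true (trans (sym (loopless-G g)) gg')

  □-triangleᴴ : ∀ g {h h'} → InTriangle {H} h h' → InTriangle {G □ H} (combine g h) (combine g h')
  □-triangleᴴ g (w , hw , h'w) = combine g w , Adj-□ᴴ g hw , Adj-□ᴴ g h'w

  private
    mapᵛ : (Fin (N G) → Fin (N G)) → (Fin (N H) → Fin (N H)) → V → V
    mapᵛ f f' x = uncurry combine (Product.map f f' (remQuot (N H) x))

    mapᵛ-∘ : ∀ f f' e e' x → mapᵛ e e' (mapᵛ f f' x) ≡ mapᵛ (λ g → e (f g)) (λ h → e' (f' h)) x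
    mapᵛ-∘ f f' e e' x = cong (uncurry combine ∘ Product.map e e') (remQuot-combine _ _)

    mapᵛ-id : ∀ {f f'} → (∀ g → f g ≡ g) → (∀ h → f' h ≡ h) → ∀ x → mapᵛ f f' x ≡ x
    mapᵛ-id f≗id f'≗id x = trans (cong₂ combine (f≗id _) (f'≗id _)) (combine-remQuot {N G} (N H) x)

  □-aut : Aut G → Aut H → Aut (G □ H)
  □-aut φ ψ = record
    { σ     = mapᵛ (σ φ) (σ ψ)
    ; σ⁻¹   = mapᵛ (σ⁻¹ φ) (σ⁻¹ ψ)
    ; left  = λ x → trans (mapᵛ-∘ (σ φ) (σ ψ) (σ⁻¹ φ) (σ⁻¹ ψ) x) (mapᵛ-id (left φ) (left ψ) x)
    ; right = λ x → trans (mapᵛ-∘ (σ⁻¹ φ) (σ⁻¹ ψ) (σ φ) (σ ψ) x) (mapᵛ-id (right φ) (right ψ) x)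
    ; pres  = λ x y → begin
        adj (G □ H) (mapᵛ (σ φ) (σ ψ) x) (mapᵛ (σ φ) (σ ψ) y)
          ≡⟨ adj-□ _ _ ⟩
        □adj (remQuot (N H) (mapᵛ (σ φ) (σ ψ) x)) (remQuot (N H) (mapᵛ (σ φ) (σ ψ) y))
          ≡⟨ cong₂ □adj (remQuot-combine _ _) (remQuot-combine _ _) ⟩
        □adj (Product.map (σ φ) (σ ψ) (remQuot (N H) x)) (Product.map (σ φ) (σ ψ) (remQuot (N H) y))
          ≡⟨ □adj-pres (remQuot (N H) x) (remQuot (N H) y) ⟩
        □adj (remQuot (N H) x) (remQuot (N H) y)
          ≡⟨ adj-□ x y ⟨
        adj (G □ H) x y ∎
    }
    where
    open ≡-Reasoning
    □adj-pres : ∀ p q → □adj (Product.map (σ φ) (σ ψ) p) (Product.map (σ φ) (σ ψ) q) ≡ □adj p q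
    □adj-pres (g , h) (g' , h') =
      cong₂ _∨_ (cong₂ _∧_ (⌊≟⌋-injective (σ-injective φ) g g') (pres ψ h h'))
                (cong₂ _∧_ (⌊≟⌋-injective (σ-injective ψ) h h') (pres φ g g'))

  σ-□-aut : ∀ φ ψ g h → σ (□-aut φ ψ) (combine g h) ≡ combine (σ φ g) (σ ψ h)
  σ-□-aut φ ψ g h = cong (uncurry combine ∘ Product.map (σ φ) (σ ψ)) (remQuot-combine g h)

  adjMul-□ : (∀ g → adj G g g ≡ false) → ∀ y g h →
             adjMul (G □ H) y (combine g h) ≡
             adjMul H (λ h' → y (combine g h')) h + adjMul G (λ g' → y (combine g' h)) g
  adjMul-□ loopless y g h = begin
    adjMul (G □ H) y (combine g h)
      ≡⟨ sumFin≡sum (N G ℕ.* N H) (λ x → entry (adj (G □ H) (combine g h) x) * y x) ⟩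
    sum {N G ℕ.* N H} (λ x → entry (adj (G □ H) (combine g h) x) * y x)
      ≡⟨ ∑-combine (N G) (N H) _ ⟩
    sum {N G} (λ g' → sum {N H} (λ h' → entry (adj (G □ H) (combine g h) (combine g' h')) * Y g' h'))
      ≡⟨ sum-cong-≗ (λ g' → trans (sum-cong-≗ (entry-split g')) (∑-distrib-+ (X g') (Z g'))) ⟩
    sum (λ g' → sum (X g') + sum (Z g'))
      ≡⟨ ∑-distrib-+ (λ g' → sum (X g')) (λ g' → sum (Z g')) ⟩
    sum (λ g' → sum (X g')) + sum (λ g' → sum (Z g'))
      ≡⟨ cong₂ _+_ (trans (sum-cong-≗ λ g' → sym (*-distribˡ-sum (δ g g') (λ h' → entry (adj H h h') * Y g' h')))
                          (∑-δ g (λ g' → sum (λ h' → entry (adj H h h') * Y g' h'))))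
                   (sum-cong-≗ (λ g' → ∑-δ h (λ h' → entry (adj G g g') * Y g' h'))) ⟩
    sum (λ h' → entry (adj H h h') * Y g h') + sum (λ g' → entry (adj G g g') * Y g' h)
      ≡⟨ cong₂ _+_ (sumFin≡sum (N H) (λ h' → entry (adj H h h') * Y g h'))
                   (sumFin≡sum (N G) (λ g' → entry (adj G g g') * Y g' h)) ⟨
    adjMul H (λ h' → y (combine g h')) h + adjMul G (λ g' → y (combine g' h)) g ∎
    where
    open ≡-Reasoning
    Y X Z : Fin (N G) → Fin (N H) → ℚ
    Y g' h' = y (combine g' h')
    X g' h' = δ g g' * (entry (adj H h h') * Y g' h')
    Z g' h' = δ h h' * (entry (adj G g g') * Y g' h')
    distrib : ∀ a b c d z → (a * b + c * d) * z ≡ a * (b * z) + c * (d * z)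
    distrib = solve-∀ ℚ-ring
    disjoint : ∀ {g' h h'} → ⌊ g ≟ g' ⌋ ∧ adj H h h' ≡ true → ⌊ h ≟ h' ⌋ ∧ adj G g g' ≡ false
    disjoint {g'} {h} {h'} p rewrite ⌊≟⌋-true {u = g} {g'} (proj₁ (∧-true p)) | loopless g' = ∧-zeroʳ _
    entry-split : ∀ g' h' → entry (adj (G □ H) (combine g h) (combine g' h')) * Y g' h' ≡ X g' h' + Z g' h'
    entry-split g' h' = begin
      entry (adj (G □ H) (combine g h) (combine g' h')) * Y g' h'
        ≡⟨ cong (λ b → entry b * Y g' h') (adj-□-combine g h g' h') ⟩
      entry ((⌊ g ≟ g' ⌋ ∧ adj H h h') ∨ (⌊ h ≟ h' ⌋ ∧ adj G g g')) * Y g' h'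
        ≡⟨ cong (_* Y g' h') (entry-∨-disjoint _ _ disjoint) ⟩
      (entry (⌊ g ≟ g' ⌋ ∧ adj H h h') + entry (⌊ h ≟ h' ⌋ ∧ adj G g g')) * Y g' h'
        ≡⟨ cong (_* Y g' h') (cong₂ _+_ (entry-∧ ⌊ g ≟ g' ⌋ (adj H h h'))
                                         (entry-∧ ⌊ h ≟ h' ⌋ (adj G g g'))) ⟩
      (δ g g' * entry (adj H h h') + δ h h' * entry (adj G g g')) * Y g' h'
        ≡⟨ distrib (δ g g') (entry (adj H h h')) (δ h h') (entry (adj G g g')) (Y g' h') ⟩
      δ g g' * (entry (adj H h h') * Y g' h') + δ h h' * (entry (adj G g g') * Y g' h') ∎

-- Cayley graphs

module Cayley {G : Graph} (cay : CayleyData G) where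

  open CayleyData cay renaming (_∙_ to infixl 7 _∙_; _⁻¹ to infix 8 _⁻¹)

  private
    V = Fin (N G)
    group : Group 0ℓ 0ℓ
    group = record { isGroup = isGroup }

  open Group group using (assoc; identityʳ; ∙-congˡ; ∙-congʳ) renaming (inverseˡ to ⁻¹-inverseˡ)
  open import Algebra.Properties.Group group
    using (ε⁻¹≈ε; ⁻¹-involutive; ⁻¹-anti-homo-∙; ⁻¹-anti-homo-\\; \\-leftDividesˡ; \\-leftDividesʳ;
           //-rightDividesʳ)

  e⁻¹≡e : e ⁻¹ ≡ e
  e⁻¹≡e = ε⁻¹≈ε

  Adj-transfer : ∀ {u v u' v'} → f u ⁻¹ ∙ f v ≡ f u' ⁻¹ ∙ f v' → Adj G u v → Adj G u' v'
  Adj-transfer {u} {v} {u'} {v'} eq p = proj₂ (adjIff u' v') (subst S eq (proj₁ (adjIff u v) p))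

  adj-cong : ∀ {u v u' v'} → f u ⁻¹ ∙ f v ≡ f u' ⁻¹ ∙ f v' → adj G u v ≡ adj G u' v'
  adj-cong eq = ⇔→≡ (mk⇔ (Adj-transfer eq) (Adj-transfer (sym eq)))

  adj-sym : ∀ u v → adj G u v ≡ adj G v u
  adj-sym u v = ⇔→≡ (mk⇔ (flip u v) (flip v u))
    where
    flip : ∀ u v → Adj G u v → Adj G v u
    flip u v p = proj₂ (adjIff v u)
      (subst S (⁻¹-anti-homo-\\ (f u) (f v)) (invClosed _ (proj₁ (adjIff u v) p)))

  quotient≡e⇔ : ∀ {u v} → f u ⁻¹ ∙ f v ≡ e ⇔ u ≡ v
  quotient≡e⇔ {u} {v} = mk⇔
    (λ q → trans (sym (gf u)) (trans (cong g (sym (trans (∙-congˡ q) (identityʳ (f u)))))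
                                      (trans (cong g (\\-leftDividesˡ (f u) (f v))) (gf v))))
    (λ { refl → ⁻¹-inverseˡ (f u) })

  translation : C → Aut G
  translation a = record
    { σ     = λ u → g (a ∙ f u)
    ; σ⁻¹   = λ u → g (a ⁻¹ ∙ f u)
    ; left  = λ u → trans (cong (λ x → g (a ⁻¹ ∙ x)) (fg _)) (trans (cong g (\\-leftDividesʳ a (f u))) (gf u))
    ; right = λ u → trans (cong (λ x → g (a ∙ x)) (fg _)) (trans (cong g (\\-leftDividesˡ a (f u))) (gf u))
    ; pres  = λ u v → adj-cong (begin
        f (g (a ∙ f u)) ⁻¹ ∙ f (g (a ∙ f v)) ≡⟨ cong₂ (λ x y → x ⁻¹ ∙ y) (fg _) (fg _) ⟩
        (a ∙ f u) ⁻¹ ∙ (a ∙ f v)            ≡⟨ ∙-congʳ (⁻¹-anti-homo-∙ a (f u)) ⟩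
        f u ⁻¹ ∙ a ⁻¹ ∙ (a ∙ f v)           ≡⟨ assoc (f u ⁻¹) (a ⁻¹) (a ∙ f v) ⟩
        f u ⁻¹ ∙ (a ⁻¹ ∙ (a ∙ f v))         ≡⟨ ∙-congˡ (\\-leftDividesʳ a (f v)) ⟩
        f u ⁻¹ ∙ f v                        ∎)
    }
    where open ≡-Reasoning

  translation-to-e : ∀ u → σ (translation (f u ⁻¹)) u ≡ g e
  translation-to-e u = cong g (⁻¹-inverseˡ (f u))

  module _ (comm : ∀ x y → x ∙ y ≡ y ∙ x) where

    inversion : Aut G
    inversion = record
      { σ     = λ u → g (f u ⁻¹)
      ; σ⁻¹   = λ u → g (f u ⁻¹)
      ; left  = involution
      ; right = involution
      ; pres  = λ u v → trans (adj-cong (begin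
          f (g (f u ⁻¹)) ⁻¹ ∙ f (g (f v ⁻¹)) ≡⟨ cong₂ (λ x y → x ⁻¹ ∙ y) (fg _) (fg _) ⟩
          f u ⁻¹ ⁻¹ ∙ f v ⁻¹                 ≡⟨ ∙-congʳ (⁻¹-involutive (f u)) ⟩
          f u ∙ f v ⁻¹                       ≡⟨ comm (f u) (f v ⁻¹) ⟩
          f v ⁻¹ ∙ f u                       ∎)) (adj-sym v u)
      }
      where
      open ≡-Reasoning
      involution : ∀ u → g (f (g (f u ⁻¹)) ⁻¹) ≡ u
      involution u = trans (cong (λ x → g (x ⁻¹)) (fg _)) (trans (cong g (⁻¹-involutive (f u))) (gf u))

    edge-flip : ∀ u v → ∃[ ρ ] σ ρ u ≡ v × σ ρ v ≡ u
    edge-flip u v = translation (f u ∙ f v) ∘ᴬ inversion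
                  , trans (cong (λ x → g (f u ∙ f v ∙ x)) (fg _))
                          (trans (cong g (trans (∙-congʳ (comm (f u) (f v))) (//-rightDividesʳ (f u) (f v)))) (gf v))
                  , trans (cong (λ x → g (f u ∙ f v ∙ x)) (fg _))
                          (trans (cong g (//-rightDividesʳ (f v) (f u))) (gf u))

module _ {G H : Graph} (cG : CayleyData G) (cH : CayleyData H) where

  private
    module A = CayleyData cG
    module B = CayleyData cH
    module Aᵍ = IsGroup A.isGroup
    module Bᵍ = IsGroup B.isGroup
    module Aᶜ = Cayley cG
    module Bᶜ = Cayley cH

  □-cayley : CayleyData (G □ H)
  □-cayley = record
    { C         = A.C × B.C
    ; _∙_       = Product.zip A._∙_ B._∙_
    ; e         = A.e , B.e
    ; _⁻¹       = Product.map A._⁻¹ B._⁻¹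
    ; isGroup   = isGroup
    ; S         = S
    ; invClosed = invClosed
    ; noUnit    = λ { (inj₁ (_ , s)) → B.noUnit s ; (inj₂ (_ , s)) → A.noUnit s }
    ; f         = Product.map A.f B.f ∘ remQuot {N G} (N H)
    ; g         = uncurry combine ∘ Product.map A.g B.g
    ; fg        = λ (a , b) → trans (cong (Product.map A.f B.f) (remQuot-combine (A.g a) (B.g b)))
                                    (cong₂ _,_ (A.fg a) (B.fg b))
    ; gf        = λ u → trans (cong₂ combine (A.gf _) (B.gf _)) (combine-remQuot {N G} (N H) u)
    ; adjIff    = λ u v → to u v , from u v
    }
    where
    S : A.C × B.C → Set
    S (a , b) = (a ≡ A.e × B.S b) ⊎ (b ≡ B.e × A.S a)

    invClosed : ∀ w → S w → S (Product.map A._⁻¹ B._⁻¹ w)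
    invClosed (a , b) (inj₁ (refl , s)) = inj₁ (Aᶜ.e⁻¹≡e , B.invClosed b s)
    invClosed (a , b) (inj₂ (refl , s)) = inj₂ (Bᶜ.e⁻¹≡e , A.invClosed a s)

    isGroup : IsGroup _≡_ (Product.zip A._∙_ B._∙_) (A.e , B.e) (Product.map A._⁻¹ B._⁻¹)
    isGroup = record
      { isMonoid = record
        { isSemigroup = record
          { isMagma = record { isEquivalence = isEquivalence ; ∙-cong = cong₂ (Product.zip A._∙_ B._∙_) }
          ; assoc = λ (a , b) (a' , b') (a'' , b'') → cong₂ _,_ (Aᵍ.assoc a a' a'') (Bᵍ.assoc b b' b'') }
        ; identity = (λ (a , b) → cong₂ _,_ (Aᵍ.identityˡ a) (Bᵍ.identityˡ b))
                   , (λ (a , b) → cong₂ _,_ (Aᵍ.identityʳ a) (Bᵍ.identityʳ b)) }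
      ; inverse = (λ (a , b) → cong₂ _,_ (Aᵍ.inverseˡ a) (Bᵍ.inverseˡ b))
                , (λ (a , b) → cong₂ _,_ (Aᵍ.inverseʳ a) (Bᵍ.inverseʳ b))
      ; ⁻¹-cong = cong (Product.map A._⁻¹ B._⁻¹) }

    quotient : Fin (N G ℕ.* N H) → Fin (N G ℕ.* N H) → A.C × B.C
    quotient u v = Product.zip A._∙_ B._∙_
                     (Product.map A._⁻¹ B._⁻¹ (Product.map A.f B.f (remQuot {N G} (N H) u)))
                     (Product.map A.f B.f (remQuot {N G} (N H) v))

    to : ∀ u v → Adj (G □ H) u v → S (quotient u v)
    to u v p with Equivalence.to (□adj-true⇔ {G = G} {H}) (trans (sym (adj-□ {G = G} {H} u v)) p)
    ... | inj₁ (≡₁ , q) = inj₁ (Equivalence.from Aᶜ.quotient≡e⇔ ≡₁ , proj₁ (B.adjIff _ _) q)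
    ... | inj₂ (≡₂ , q) = inj₂ (Equivalence.from Bᶜ.quotient≡e⇔ ≡₂ , proj₁ (A.adjIff _ _) q)

    from : ∀ u v → S (quotient u v) → Adj (G □ H) u v
    from u v s = trans (adj-□ {G = G} {H} u v) (Equivalence.from (□adj-true⇔ {G = G} {H}) (from′ s))
      where
      u₁ v₁ : Fin (N G)
      u₁ = proj₁ (remQuot {N G} (N H) u)
      v₁ = proj₁ (remQuot {N G} (N H) v)
      u₂ v₂ : Fin (N H)
      u₂ = proj₂ (remQuot {N G} (N H) u)
      v₂ = proj₂ (remQuot {N G} (N H) v)
      from′ : S (quotient u v) → (u₁ ≡ v₁ × Adj H u₂ v₂) ⊎ (u₂ ≡ v₂ × Adj G u₁ v₁)
      from′ (inj₁ (≡₁ , s)) = inj₁ (Equivalence.to Aᶜ.quotient≡e⇔ ≡₁ , proj₂ (B.adjIff _ _) s)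
      from′ (inj₂ (≡₂ , s)) = inj₂ (Equivalence.to Bᶜ.quotient≡e⇔ ≡₂ , proj₂ (A.adjIff _ _) s)

-- Circulant graphs

module _ (m : ℕ) .{{m≢0 : NonZero m}} where

  open Modular m {{m≢0}}

  connection : List ℕ → Fin m → Bool
  connection S w = any (λ s → (toℕ w ≡ᵇ s) ∨ (toℕ (⊖ w) ≡ᵇ s)) S

  circAdj-connection : ∀ S u v → circAdj m S u v ≡ connection S (⊖ u ⊕ v)
  circAdj-connection S u v rewrite diffMod-≡ u v | diffMod-≡ v u | ⁻¹-anti-homo-\\ u v = refl

  connection-⊖ : ∀ S w → connection S (⊖ w) ≡ connection S w
  connection-⊖ S w rewrite ⁻¹-involutive w =
    cong or (map-cong (λ s → ∨-comm (toℕ (⊖ w) ≡ᵇ s) (toℕ w ≡ᵇ s)) S)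

  connection-𝟘 : ∀ {S} → All NonZero S → connection S 𝟘 ≡ false
  connection-𝟘 nz rewrite ε⁻¹≈ε | toℕ-𝟘 = go nz
    where
    go : ∀ {S} → All NonZero S → any (λ s → (0 ≡ᵇ s) ∨ (0 ≡ᵇ s)) S ≡ false
    go []                    = refl
    go {suc _ ∷ _} (_ ∷ nz) = go nz

  circ-cayley : ∀ S → All NonZero S → CayleyData (circ m S)
  circ-cayley S nz = record
    { C = Fin m ; _∙_ = _⊕_ ; e = 𝟘 ; _⁻¹ = ⊖_ ; isGroup = IsAbelianGroup.isGroup isAbelianGroup
    ; S = λ w → connection S w ≡ true
    ; invClosed = λ w p → trans (connection-⊖ S w) p
    ; noUnit = λ p → case trans (sym (connection-𝟘 nz)) p of λ ()
    ; f = λ u → u ; g = λ u → u ; fg = λ _ → refl ; gf = λ _ → refl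
    ; adjIff = λ u v → trans (sym (circAdj-connection S u v)) , trans (circAdj-connection S u v)
    }

K-cayley : ∀ k .{{_ : NonZero k}} → CayleyData (K k)
K-cayley k = record
  { C = Fin k ; _∙_ = _⊕_ ; e = 𝟘 ; _⁻¹ = ⊖_ ; isGroup = IsAbelianGroup.isGroup isAbelianGroup
  ; S = λ w → w ≢ 𝟘
  ; invClosed = λ w w≢𝟘 ⊖w≡𝟘 → w≢𝟘 (⁻¹-injective (trans ⊖w≡𝟘 (sym ε⁻¹≈ε)))
  ; noUnit = λ 𝟘≢𝟘 → 𝟘≢𝟘 refl
  ; f = λ u → u ; g = λ u → u ; fg = λ _ → refl ; gf = λ _ → refl
  ; adjIff = λ u v → to u v , from u v
  }
  where
  open Modular k
  to : ∀ u v → not ⌊ u ≟ v ⌋ ≡ true → ⊖ u ⊕ v ≢ 𝟘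
  to u v p q with u ≟ v
  ... | yes _   = case p of λ ()
  ... | no u≢v = u≢v (Equivalence.to ⊖⊕≡𝟘⇔ q)
  from : ∀ u v → ⊖ u ⊕ v ≢ 𝟘 → not ⌊ u ≟ v ⌋ ≡ true
  from u v q with u ≟ v
  ... | yes u≡v = ⊥-elim (q (Equivalence.from ⊖⊕≡𝟘⇔ u≡v))
  ... | no _    = refl

-- Eigenfunctions of the cycle

module Cycle (m : ℕ) .{{m≢0 : NonZero m}} where

  open Modular m {{m≢0}}

  one : Fin m
  one = ι 1

  CycleEq : ℚ → (Fin m → ℚ) → Set
  CycleEq β p = ∀ g → p (g ⊕ one) + p (g ⊕ ⊖ one) + β * p g ≡ 0ℚ

  cycleEq-neighbours : ∀ {β p} → CycleEq β p → ∀ g → p (g ⊕ one) + p (g ⊕ ⊖ one) ≡ - (β * p g)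
  cycleEq-neighbours eq g = x+y≡0⇒x≡-y _ _ (eq g)

  ⊕ι-suc : ∀ g k → g ⊕ ι (suc k) ≡ g ⊕ ι k ⊕ one
  ⊕ι-suc g k = trans (cong (g ⊕_) (trans (cong ι (ℕP.+-comm 1 k)) (ι-+ k 1))) (sym (⊕-assoc g (ι k) one))

  reach : ∀ g h → g ⊕ ι (toℕ (⊖ g ⊕ h)) ≡ h
  reach g h = trans (cong (g ⊕_) (ι-toℕ _)) (\\-leftDividesˡ g h)

  maximum : (f : Fin m → ℚ) → ∃[ g* ] ∀ g → f g ℚ.≤ f g*
  maximum f = argmax f 𝟘 (allFin m) , λ g → All.lookup (f[xs]≤f[argmax] 𝟘 (allFin m)) (∈-allFin g)

  -- Maximum principle: p (g + 1) + p (g − 1) = 2 p g forces the maximum of p onto the next vertex.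
  cycleEq[-2]⇒constant : ∀ {p} → CycleEq (- (1ℚ + 1ℚ)) p → ∀ g → p g ≡ p 𝟘
  cycleEq[-2]⇒constant {p} eq g = trans (everywhere g) (sym (everywhere 𝟘))
    where
    g* : Fin m
    g* = proj₁ (maximum p)
    M : ℚ
    M = p g*
    squeeze : ∀ {a b} → a ℚ.≤ M → b ℚ.≤ M → a + b ≡ M + M → a ≡ M
    squeeze {a} {b} a≤M b≤M a+b≡2M = ℚP.≤-antisym a≤M (subst₂ ℚ._≤_ (cancelʳ M M) (cancelʳ a M)
      (ℚP.+-monoˡ-≤ (- M) (subst (ℚ._≤ a + M) a+b≡2M (ℚP.+-monoʳ-≤ a b≤M))))
      where
      cancelʳ : ∀ x y → x + y + - y ≡ x
      cancelʳ = solve-∀ ℚ-ring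
    next : ∀ h → p h ≡ M → p (h ⊕ one) ≡ M
    next h ph≡M = squeeze (proj₂ (maximum p) _) (proj₂ (maximum p) _)
      (trans (cycleEq-neighbours { - (1ℚ + 1ℚ)} {p} eq h) (trans (double (p h)) (cong (λ x → x + x) ph≡M)))
      where
      double : ∀ x → - (- (1ℚ + 1ℚ) * x) ≡ x + x
      double = solve-∀ ℚ-ring
    along : ∀ k → p (g* ⊕ ι k) ≡ M
    along zero    = cong p (identityʳ g*)
    along (suc k) = trans (cong p (⊕ι-suc g* k)) (next _ (along k))
    everywhere : ∀ g → p g ≡ M
    everywhere g = trans (cong p (sym (reach g* g))) (along _)

  module _ (2∣m : 2 ∣ m) where

    sign-one : sign (toℕ one) ≡ - 1ℚ
    sign-one = trans (cong sign (toℕ-ι 1)) (sign-% 1 2∣m)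

    sign-⊕one : ∀ g → sign (toℕ (g ⊕ one)) ≡ - sign (toℕ g)
    sign-⊕one g = trans (sign-⊕ 2∣m g one) (trans (cong (sign (toℕ g) *_) sign-one) (x*-1≡-x (sign (toℕ g))))

    sign-⊕⊖one : ∀ g → sign (toℕ (g ⊕ ⊖ one)) ≡ - sign (toℕ g)
    sign-⊕⊖one g = trans (sign-⊕ 2∣m g (⊖ one))
                         (trans (cong (sign (toℕ g) *_) (trans (sign-⊖ 2∣m one) sign-one)) (x*-1≡-x (sign (toℕ g))))

    -- Twisting by the sign character exchanges the eigenvalues 2 and -2.
    cycleEq[2]⇒alternating : ∀ {p} → CycleEq (1ℚ + 1ℚ) p → ∀ g → p g ≡ sign (toℕ g) * p 𝟘
    cycleEq[2]⇒alternating {p} eq g = begin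
      p g                                   ≡⟨ ℚP.*-identityˡ (p g) ⟨
      1ℚ * p g                              ≡⟨ cong (_* p g) (sign² (toℕ g)) ⟨
      sign (toℕ g) * sign (toℕ g) * p g     ≡⟨ ℚP.*-assoc (sign (toℕ g)) _ _ ⟩
      sign (toℕ g) * s g                    ≡⟨ cong (sign (toℕ g) *_) (cycleEq[-2]⇒constant {s} s-eq g) ⟩
      sign (toℕ g) * s 𝟘                    ≡⟨ cong (λ x → sign (toℕ g) * (sign x * p 𝟘)) toℕ-𝟘 ⟩
      sign (toℕ g) * (1ℚ * p 𝟘)             ≡⟨ cong (sign (toℕ g) *_) (ℚP.*-identityˡ (p 𝟘)) ⟩
      sign (toℕ g) * p 𝟘                    ∎
      where
      open ≡-Reasoning
      s : Fin m → ℚ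
      s h = sign (toℕ h) * p h
      twist : ∀ σ a b c → - σ * a + - σ * b + - (1ℚ + 1ℚ) * (σ * c) ≡ - σ * (a + b + (1ℚ + 1ℚ) * c)
      twist = solve-∀ ℚ-ring
      s-eq : CycleEq (- (1ℚ + 1ℚ)) s
      s-eq h = begin
        s (h ⊕ one) + s (h ⊕ ⊖ one) + - (1ℚ + 1ℚ) * s h
          ≡⟨ cong₂ (λ x y → x * p (h ⊕ one) + y * p (h ⊕ ⊖ one) + - (1ℚ + 1ℚ) * s h)
                   (sign-⊕one h) (sign-⊕⊖one h) ⟩
        - sign (toℕ h) * p (h ⊕ one) + - sign (toℕ h) * p (h ⊕ ⊖ one) + - (1ℚ + 1ℚ) * s h
          ≡⟨ twist (sign (toℕ h)) (p (h ⊕ one)) (p (h ⊕ ⊖ one)) (p h) ⟩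
        - sign (toℕ h) * (p (h ⊕ one) + p (h ⊕ ⊖ one) + (1ℚ + 1ℚ) * p h)
          ≡⟨ cong (- sign (toℕ h) *_) (eq h) ⟩
        - sign (toℕ h) * 0ℚ
          ≡⟨ ℚP.*-zeroʳ (- sign (toℕ h)) ⟩
        0ℚ ∎

  cycleEq-large⇒zero : ∀ {β p} → 1ℚ + 1ℚ ℚ.< ℚ.∣ β ∣ → CycleEq β p → ∀ g → p g ≡ 0ℚ
  cycleEq-large⇒zero {β} {p} 2<∣β∣ eq g =
    ℚP.∣p∣≡0⇒p≡0 (p g) (ℚP.≤-antisym (ℚP.≤-trans (proj₂ (maximum ∣p∣) g) A≤0) (ℚP.0≤∣p∣ (p g)))
    where
    ∣p∣ : Fin m → ℚ
    ∣p∣ h = ℚ.∣ p h ∣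
    g* : Fin m
    g* = proj₁ (maximum ∣p∣)
    A : ℚ
    A = ∣p∣ g*
    ∣β∣A≤2A : ℚ.∣ β ∣ * A ℚ.≤ A + A
    ∣β∣A≤2A = begin
      ℚ.∣ β ∣ * ℚ.∣ p g* ∣                         ≡⟨ ℚP.∣p*q∣≡∣p∣*∣q∣ β (p g*) ⟨
      ℚ.∣ β * p g* ∣                               ≡⟨ ℚP.∣-p∣≡∣p∣ (β * p g*) ⟨
      ℚ.∣ - (β * p g*) ∣                           ≡⟨ cong ℚ.∣_∣ (cycleEq-neighbours {β} {p} eq g*) ⟨
      ℚ.∣ p (g* ⊕ one) + p (g* ⊕ ⊖ one) ∣
        ≤⟨ ℚP.∣p+q∣≤∣p∣+∣q∣ (p (g* ⊕ one)) (p (g* ⊕ ⊖ one)) ⟩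
      ℚ.∣ p (g* ⊕ one) ∣ + ℚ.∣ p (g* ⊕ ⊖ one) ∣
        ≤⟨ ℚP.+-mono-≤ (proj₂ (maximum ∣p∣) _) (proj₂ (maximum ∣p∣) _) ⟩
      A + A                                        ∎
      where open ℚP.≤-Reasoning
    A≤0 : A ℚ.≤ 0ℚ
    A≤0 = ℚP.≮⇒≥ λ 0<A → ℚP.<-irrefl refl (ℚP.<-≤-trans (2A<∣β∣A 0<A) ∣β∣A≤2A)
      where
      2A<∣β∣A : 0ℚ ℚ.< A → A + A ℚ.< ℚ.∣ β ∣ * A
      2A<∣β∣A 0<A = subst (ℚ._< ℚ.∣ β ∣ * A) (2*x≡x+x A) (ℚP.*-monoˡ-<-pos A {{ℚ.positive 0<A}} 2<∣β∣)

  module _ (n : ℕ) (n-odd : n % 2 ≡ 1) (n*2≡m : n ℕ.* 2 ≡ m) where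

    -- Two steps along the cycle flip the sign; n double steps go once around.
    cycleEq[0]⇒zero : ∀ {p} → CycleEq 0ℚ p → ∀ g → p g ≡ 0ℚ
    cycleEq[0]⇒zero {p} eq g = x≡-x⇒x≡0 (p g) (begin
      p g                           ≡⟨ cong p (identityʳ g) ⟨
      p (g ⊕ 𝟘)                     ≡⟨ cong (λ x → p (g ⊕ x)) (trans (cong ι n*2≡m) (ι-+m 0)) ⟨
      p (g ⊕ ι (n ℕ.* 2))           ≡⟨ double-steps n ⟩
      sign n * p g                  ≡⟨ cong (_* p g) (sign-odd n n-odd) ⟩
      - 1ℚ * p g                    ≡⟨ ℚP.neg-distribˡ-* 1ℚ (p g) ⟨
      - (1ℚ * p g)                  ≡⟨ cong -_ (ℚP.*-identityˡ (p g)) ⟩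
      - p g                         ∎)
      where
      open ≡-Reasoning
      two-steps : ∀ h → p (h ⊕ one ⊕ one) ≡ - p h
      two-steps h = x+y≡0⇒x≡-y _ _ (begin
        p (h ⊕ one ⊕ one) + p h
          ≡⟨ cong (λ x → p (h ⊕ one ⊕ one) + p x) (//-rightDividesʳ one h) ⟨
        p (h ⊕ one ⊕ one) + p (h ⊕ one ⊕ ⊖ one)  ≡⟨ cycleEq-neighbours {0ℚ} {p} eq (h ⊕ one) ⟩
        - (0ℚ * p (h ⊕ one))                      ≡⟨ cong -_ (ℚP.*-zeroˡ (p (h ⊕ one))) ⟩
        0ℚ                                        ∎)
      double-steps : ∀ j → p (g ⊕ ι (j ℕ.* 2)) ≡ sign j * p g
      double-steps zero    = trans (cong p (identityʳ g)) (sym (ℚP.*-identityˡ (p g)))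
      double-steps (suc j) = begin
        p (g ⊕ ι (suc (suc (j ℕ.* 2))))     ≡⟨ cong p (trans (⊕ι-suc g _) (cong (_⊕ one) (⊕ι-suc g _))) ⟩
        p (g ⊕ ι (j ℕ.* 2) ⊕ one ⊕ one)     ≡⟨ two-steps _ ⟩
        - p (g ⊕ ι (j ℕ.* 2))               ≡⟨ cong -_ (double-steps j) ⟩
        - (sign j * p g)                    ≡⟨ ℚP.neg-distribˡ-* (sign j) (p g) ⟩
        sign (suc j) * p g                  ∎

-- The Möbius ladder Circ(2n, {1, n})

module MöbiusLadder (n : ℕ) (n-odd : n % 2 ≡ 1) where

  private
    n≢0 : n ≢ 0
    n≢0 refl = case n-odd of λ ()

  instance
    _ : NonZero n
    _ = ℕ.≢-nonZero n≢0

  m : ℕ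
  m = 2 ℕ.* n

  instance
    m≢0 : NonZero m
    m≢0 = ℕP.m*n≢0 2 n

  open Modular m public
  open Cycle m public

  2∣m : 2 ∣ m
  2∣m = divides n (ℕP.*-comm 2 n)

  half : Fin m
  half = ι n

  half⊕half : half ⊕ half ≡ 𝟘
  half⊕half = trans (sym (ι-+ n n)) (trans (cong (λ k → ι (n ℕ.+ k)) (sym (ℕP.+-identityʳ n))) (ι-+m 0))

  ⊖half : ⊖ half ≡ half
  ⊖half = sym (inverseʳ-unique half half half⊕half)

  MöbiusEq : ℚ → (Fin m → ℚ) → Set
  MöbiusEq α f = ∀ g → f (g ⊕ one) + f (g ⊕ ⊖ one) + f (g ⊕ half) + α * f g ≡ 0ℚ

  -- The half-turn g ↦ g ⊕ half commutes with A; its ±1-eigenparts P and R of f solve cycle equations.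
  module Split {α : ℚ} {f : Fin m → ℚ} (eq : MöbiusEq α f) where

    P R : Fin m → ℚ
    P g = f g + f (g ⊕ half)
    R g = f g - f (g ⊕ half)

    private
      half-comm : ∀ g s → g ⊕ s ⊕ half ≡ g ⊕ half ⊕ s
      half-comm g s = trans (⊕-assoc g s half) (trans (cong (g ⊕_) (⊕-comm s half)) (sym (⊕-assoc g half s)))

      half-twice : ∀ g → g ⊕ half ⊕ half ≡ g
      half-twice g = trans (⊕-assoc g half half) (trans (cong (g ⊕_) half⊕half) (identityʳ g))

      eq′ : ∀ g → f (g ⊕ one ⊕ half) + f (g ⊕ ⊖ one ⊕ half) + f g + α * f (g ⊕ half) ≡ 0ℚ
      eq′ g = subst₂ (λ x y → f x + f y + f g + α * f (g ⊕ half) ≡ 0ℚ)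
                     (sym (half-comm g one)) (sym (half-comm g (⊖ one)))
                     (subst (λ x → f (g ⊕ half ⊕ one) + f (g ⊕ half ⊕ ⊖ one) + f x + α * f (g ⊕ half) ≡ 0ℚ)
                            (half-twice g) (eq (g ⊕ half)))

      sum-identity : ∀ a b c d a' b' α → (a + a') + (b + b') + (1ℚ + α) * (d + c) ≡
                                         (a + b + c + α * d) + (a' + b' + d + α * c)
      sum-identity = solve-∀ ℚ-ring

      diff-identity : ∀ a b c d a' b' α → (a - a') + (b - b') + (α - 1ℚ) * (d - c) ≡
                                          (a + b + c + α * d) - (a' + b' + d + α * c)
      diff-identity = solve-∀ ℚ-ring

    P-eq : CycleEq (1ℚ + α) P
    P-eq g = trans (sum-identity (f (g ⊕ one)) (f (g ⊕ ⊖ one)) (f (g ⊕ half)) (f g)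
                                 (f (g ⊕ one ⊕ half)) (f (g ⊕ ⊖ one ⊕ half)) α)
                   (trans (cong₂ _+_ (eq g) (eq′ g)) (ℚP.+-identityʳ 0ℚ))

    R-eq : CycleEq (α - 1ℚ) R
    R-eq g = trans (diff-identity (f (g ⊕ one)) (f (g ⊕ ⊖ one)) (f (g ⊕ half)) (f g)
                                  (f (g ⊕ one ⊕ half)) (f (g ⊕ ⊖ one ⊕ half)) α)
                   (trans (cong₂ _-_ (eq g) (eq′ g)) (ℚP.+-inverseʳ 0ℚ))

    R-antiperiodic : ∀ g → R (g ⊕ half) ≡ - R g
    R-antiperiodic g = trans (cong (λ x → f (g ⊕ half) - f x) (half-twice g)) (swap (f g) (f (g ⊕ half)))
      where
      swap : ∀ x y → y - x ≡ - (x - y)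
      swap = solve-∀ ℚ-ring

    reconstruct : ∀ g → f g ≡ ℚ.½ * (P g + R g)
    reconstruct g = trans (sym (½*2* (f g))) (cong (ℚ.½ *_) (split (f g) (f (g ⊕ half))))
      where
      split : ∀ x y → (1ℚ + 1ℚ) * x ≡ (x + y) + (x - y)
      split = solve-∀ ℚ-ring

  n*2≡m : n ℕ.* 2 ≡ m
  n*2≡m = ℕP.*-comm n 2

  möbiusEq[-1]⇒zero : ∀ {f} → MöbiusEq (- 1ℚ) f → ∀ g → f g ≡ 0ℚ
  möbiusEq[-1]⇒zero {f} eq g = begin
    f g                    ≡⟨ reconstruct g ⟩
    ℚ.½ * (P g + R g)      ≡⟨ cong₂ (λ x y → ℚ.½ * (x + y)) (cycleEq[0]⇒zero n n-odd n*2≡m {P} P-eq g)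
                                                            (R≡0 g) ⟩
    ℚ.½ * (0ℚ + 0ℚ)        ≡⟨⟩
    0ℚ                     ∎
    where
    open ≡-Reasoning
    open Split {α = - 1ℚ} {f} eq
    R≡R𝟘 : ∀ g → R g ≡ R 𝟘
    R≡R𝟘 = cycleEq[-2]⇒constant {R} R-eq
    R≡0 : ∀ g → R g ≡ 0ℚ
    R≡0 g = trans (R≡R𝟘 g) (x≡-x⇒x≡0 (R 𝟘) (trans (sym (R≡R𝟘 (𝟘 ⊕ half))) (R-antiperiodic 𝟘)))

  möbiusEq[3]⇒alternating : ∀ {f} → MöbiusEq (1ℚ + 1ℚ + 1ℚ) f → ∀ g → f g ≡ sign (toℕ g) * f 𝟘
  möbiusEq[3]⇒alternating {f} eq g = begin
    f g                                ≡⟨ f≡½R g ⟩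
    ℚ.½ * R g                          ≡⟨ cong (ℚ.½ *_) (cycleEq[2]⇒alternating 2∣m {R} R-eq g) ⟩
    ℚ.½ * (sign (toℕ g) * R 𝟘)         ≡⟨ reorder ℚ.½ (sign (toℕ g)) (R 𝟘) ⟩
    sign (toℕ g) * (ℚ.½ * R 𝟘)         ≡⟨ cong (sign (toℕ g) *_) (f≡½R 𝟘) ⟨
    sign (toℕ g) * f 𝟘                 ∎
    where
    open ≡-Reasoning
    open Split {α = 1ℚ + 1ℚ + 1ℚ} {f} eq
    2<4 : 1ℚ + 1ℚ ℚ.< ℚ.∣ 1ℚ + (1ℚ + 1ℚ + 1ℚ) ∣
    2<4 = from-yes (1ℚ + 1ℚ ℚP.<? ℚ.∣ 1ℚ + (1ℚ + 1ℚ + 1ℚ) ∣)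
    f≡½R : ∀ g → f g ≡ ℚ.½ * R g
    f≡½R g = trans (reconstruct g) (cong (ℚ.½ *_) (trans (cong (_+ R g) (cycleEq-large⇒zero {p = P} 2<4 P-eq g))
                                                         (ℚP.+-identityˡ (R g))))
    reorder : ∀ c s r → c * (s * r) ≡ s * (c * r)
    reorder = solve-∀ ℚ-ring

  Ladder : Graph
  Ladder = circ m (1 ∷ n ∷ [])

  Generator : Fin m → Set
  Generator s = s ≡ one ⊎ s ≡ ⊖ one ⊎ s ≡ half

  private
    generators≢0 : All NonZero (1 ∷ n ∷ [])
    generators≢0 = _ ∷ ℕ.≢-nonZero n≢0 ∷ []

  Ladder-cayley : CayleyData Ladder
  Ladder-cayley = circ-cayley m (1 ∷ n ∷ []) generators≢0

  Ladder-sym : ∀ u v → Adj Ladder u v → Adj Ladder v u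
  Ladder-sym u v p = trans (Cayley.adj-sym Ladder-cayley v u) p

  1<m : 1 < m
  1<m = ℕP.*-monoʳ-≤ 2 (ℕ.>-nonZero⁻¹ n)

  n<m : n < m
  n<m = ℕP.m<m+n n (subst (0 <_) (sym (ℕP.+-identityʳ n)) (ℕ.>-nonZero⁻¹ n))

  toℕ-one : toℕ one ≡ 1
  toℕ-one = trans (toℕ-ι 1) (m<n⇒m%n≡m 1<m)

  toℕ-half : toℕ half ≡ n
  toℕ-half = trans (toℕ-ι n) (m<n⇒m%n≡m n<m)

  private
    ≡ᵇ-true : ∀ a b → (a ≡ᵇ b) ≡ true → a ≡ b
    ≡ᵇ-true a b e = ℕP.≡ᵇ⇒≡ a b (subst T (sym e) _)

    ≡⇒≡ᵇ-true : ∀ a b → a ≡ b → (a ≡ᵇ b) ≡ true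
    ≡⇒≡ᵇ-true a b e = Equivalence.to T-≡ (ℕP.≡⇒≡ᵇ a b e)

  connection⇔ : ∀ w → connection m (1 ∷ n ∷ []) w ≡ true ⇔ Generator w
  connection⇔ w = mk⇔ to from
    where
    is : ℕ → Fin m → Bool
    is k x = toℕ x ≡ᵇ k
    to : connection m (1 ∷ n ∷ []) w ≡ true → Generator w
    to p with ∨-true⁻ (is 1 w ∨ is 1 (⊖ w)) _ p
    ... | inj₁ q with ∨-true⁻ (is 1 w) (is 1 (⊖ w)) q
    ...   | inj₁ r = inj₁ (toℕ-injective (trans (≡ᵇ-true _ 1 r) (sym toℕ-one)))
    ...   | inj₂ r = inj₂ (inj₁ (⊖-swap (toℕ-injective (trans (≡ᵇ-true _ 1 r) (sym toℕ-one)))))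
    to p | inj₂ q with ∨-true⁻ (is n w ∨ is n (⊖ w)) false q
    ...   | inj₂ ()
    ...   | inj₁ q′ with ∨-true⁻ (is n w) (is n (⊖ w)) q′
    ...     | inj₁ r = inj₂ (inj₂ (toℕ-injective (trans (≡ᵇ-true _ n r) (sym toℕ-half))))
    ...     | inj₂ r =
      inj₂ (inj₂ (trans (⊖-swap (toℕ-injective (trans (≡ᵇ-true _ n r) (sym toℕ-half)))) ⊖half))
    from : Generator w → connection m (1 ∷ n ∷ []) w ≡ true
    from (inj₁ refl) =
      ∨-trueˡ _ _ (∨-trueˡ (is 1 one) _ (≡⇒≡ᵇ-true _ 1 toℕ-one))
    from (inj₂ (inj₁ refl)) =
      ∨-trueˡ _ _ (∨-trueʳ (is 1 (⊖ one)) _ (≡⇒≡ᵇ-true _ 1 (trans (cong toℕ (⁻¹-involutive one)) toℕ-one)))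
    from (inj₂ (inj₂ refl)) =
      ∨-trueʳ (is 1 half ∨ is 1 (⊖ half)) _ (∨-trueˡ _ false (∨-trueˡ (is n half) _ (≡⇒≡ᵇ-true _ n toℕ-half)))

  Adj⇔ : ∀ u v → Adj Ladder u v ⇔ Generator (⊖ u ⊕ v)
  Adj⇔ u v = subst (λ b → b ≡ true ⇔ Generator (⊖ u ⊕ v)) (sym (circAdj-connection m (1 ∷ n ∷ []) u v))
                   (connection⇔ (⊖ u ⊕ v))

  Adj-step : ∀ u {s} → Generator s → Adj Ladder u (u ⊕ s)
  Adj-step u {s} gen = Equivalence.from (Adj⇔ u (u ⊕ s)) (subst Generator (sym (\\-leftDividesʳ u s)) gen)

  Adj-step⁻ : ∀ u v → Adj Ladder u v → ∃[ s ] Generator s × v ≡ u ⊕ s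
  Adj-step⁻ u v p = ⊖ u ⊕ v , Equivalence.to (Adj⇔ u v) p , sym (\\-leftDividesˡ u v)

  Ladder-loopless : ∀ u → adj Ladder u u ≡ false
  Ladder-loopless u = trans (circAdj-connection m (1 ∷ n ∷ []) u u)
                            (trans (cong (connection m (1 ∷ n ∷ [])) (⊖-inverseˡ u)) (connection-𝟘 m generators≢0))

  sign-generator : ∀ {s} → Generator s → sign (toℕ s) ≡ - 1ℚ
  sign-generator (inj₁ refl)        = sign-one 2∣m
  sign-generator (inj₂ (inj₁ refl)) = trans (sign-⊖ 2∣m one) (sign-one 2∣m)
  sign-generator (inj₂ (inj₂ refl)) = trans (cong sign toℕ-half) (sign-odd n n-odd)

  Adj-sign : ∀ u v → Adj Ladder u v → sign (toℕ v) ≡ - sign (toℕ u)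
  Adj-sign u v p with Adj-step⁻ u v p
  ... | s , gen , v≡u⊕s = begin
    sign (toℕ v)                ≡⟨ cong (sign ∘ toℕ) v≡u⊕s ⟩
    sign (toℕ (u ⊕ s))          ≡⟨ sign-⊕ 2∣m u s ⟩
    sign (toℕ u) * sign (toℕ s) ≡⟨ cong (sign (toℕ u) *_) (sign-generator gen) ⟩
    sign (toℕ u) * - 1ℚ         ≡⟨ x*-1≡-x (sign (toℕ u)) ⟩
    - sign (toℕ u)              ∎
    where open ≡-Reasoning

  Ladder-triangle-free : ∀ u v → Adj Ladder u v → ¬ InTriangle {Ladder} u v
  Ladder-triangle-free = alternating⇒triangle-free (sign ∘ toℕ) (sign≢0 ∘ toℕ) Adj-sign

  module _ (5≤n : 5 ≤ n) where

    private
      3+n<m : 3 ℕ.+ n < m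
      3+n<m = subst (3 ℕ.+ n <_) (cong (n ℕ.+_) (sym (ℕP.+-identityʳ n)))
                    (ℕP.+-monoˡ-< n (ℕP.≤-trans (ℕP.n≤1+n 4) 5≤n))

      ≤4⇒≤3+n : ∀ {k} → k ≤ 4 → k ≤ 3 ℕ.+ n
      ≤4⇒≤3+n k≤4 = ℕP.≤-trans k≤4 (ℕP.+-monoʳ-≤ 3 (ℕP.≤-trans (s≤s z≤n) 5≤n))

      ι-≢ : ∀ {x y} → x ≤ 3 ℕ.+ n → y ≤ 3 ℕ.+ n → x ≢ y → ι x ≢ ι y
      ι-≢ x≤ y≤ x≢y = x≢y ∘ ι-injective (ℕP.≤-<-trans x≤ 3+n<m) (ℕP.≤-<-trans y≤ 3+n<m)

      n≤3+n : n ≤ 3 ℕ.+ n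
      n≤3+n = ℕP.m≤n+m n 3

      1≢n : 1 ≢ n
      1≢n = ℕP.<⇒≢ (ℕP.≤-trans (s≤s (s≤s z≤n)) 5≤n)

      3≢n : 3 ≢ n
      3≢n = ℕP.<⇒≢ (ℕP.≤-trans (ℕP.n≤1+n 4) 5≤n)

      ι-¬generator : ∀ k → suc k ≤ 3 ℕ.+ n → k ≢ 1 → k ≢ n → ¬ Generator (ι k)
      ι-¬generator k k<3+n k≢1 k≢n (inj₁ e)        = ι-≢ (ℕP.<⇒≤ k<3+n) (≤4⇒≤3+n (s≤s z≤n)) k≢1 e
      ι-¬generator k k<3+n k≢1 k≢n (inj₂ (inj₁ e)) =
        ι-≢ k<3+n z≤n (λ ()) (trans (ι-+ 1 k) (trans (cong (one ⊕_) e) (inverseʳ one)))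
      ι-¬generator k k<3+n k≢1 k≢n (inj₂ (inj₂ e)) = ι-≢ (ℕP.<⇒≤ k<3+n) n≤3+n k≢n e

    one≢⊖one : one ≢ ⊖ one
    one≢⊖one e = ι-≢ (≤4⇒≤3+n (s≤s (s≤s z≤n))) z≤n (λ ())
      (trans (ι-+ 1 1) (trans (cong (one ⊕_) e) (inverseʳ one)))

    one≢half : one ≢ half
    one≢half = ι-≢ (≤4⇒≤3+n (s≤s z≤n)) n≤3+n 1≢n

    ⊖one≢half : ⊖ one ≢ half
    ⊖one≢half e = one≢half (trans (⊖-swap e) ⊖half)

    private
      ⊕-≢ : ∀ g {s t} → s ≢ t → g ⊕ s ≢ g ⊕ t
      ⊕-≢ g s≢t e = s≢t (∙-cancelˡ g _ _ e)

      non-neighbour : ∀ {g g'} → adj Ladder g g' ≡ false → ∀ {s} → Generator s → g ⊕ s ≢ g'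
      non-neighbour {g} e gen refl = false≢true (trans (sym e) (Adj-step g gen))

    entry-adj : ∀ g g' → entry (adj Ladder g g') ≡ δ (g ⊕ one) g' + δ (g ⊕ ⊖ one) g' + δ (g ⊕ half) g'
    entry-adj g g' with adj Ladder g g' in e
    ... | false = sym (cong₂ _+_ (cong₂ _+_ (δ-≢ (non-neighbour e (inj₁ refl)))
                                            (δ-≢ (non-neighbour e (inj₂ (inj₁ refl)))))
                                 (δ-≢ (non-neighbour e (inj₂ (inj₂ refl)))))
    ... | true with Adj-step⁻ g g' e
    ...   | _ , inj₁ refl , refl =
      sym (cong₂ _+_ (cong₂ _+_ (δ-self (g ⊕ one)) (δ-≢ (⊕-≢ g (one≢⊖one ∘ sym))))
                     (δ-≢ (⊕-≢ g (one≢half ∘ sym))))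
    ...   | _ , inj₂ (inj₁ refl) , refl =
      sym (cong₂ _+_ (cong₂ _+_ (δ-≢ (⊕-≢ g one≢⊖one)) (δ-self (g ⊕ ⊖ one)))
                     (δ-≢ (⊕-≢ g (⊖one≢half ∘ sym))))
    ...   | _ , inj₂ (inj₂ refl) , refl =
      sym (cong₂ _+_ (cong₂ _+_ (δ-≢ (⊕-≢ g one≢half)) (δ-≢ (⊕-≢ g ⊖one≢half)))
                     (δ-self (g ⊕ half)))

    adjMul-Ladder : ∀ f g → adjMul Ladder f g ≡ f (g ⊕ one) + f (g ⊕ ⊖ one) + f (g ⊕ half)
    adjMul-Ladder f g = begin
      adjMul Ladder f g
        ≡⟨ sumFin≡sum m (λ g' → entry (adj Ladder g g') * f g') ⟩
      sum (λ g' → entry (adj Ladder g g') * f g')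
        ≡⟨ sum-cong-≗ (λ g' → trans (cong (_* f g') (entry-adj g g'))
                                      (distrib (δ (g ⊕ one) g') (δ (g ⊕ ⊖ one) g') (δ (g ⊕ half) g') (f g'))) ⟩
      sum (λ g' → δ (g ⊕ one) g' * f g' + δ (g ⊕ ⊖ one) g' * f g' + δ (g ⊕ half) g' * f g')
        ≡⟨ ∑-distrib-+ (λ g' → δ (g ⊕ one) g' * f g' + δ (g ⊕ ⊖ one) g' * f g')
                       (λ g' → δ (g ⊕ half) g' * f g') ⟩
      sum (λ g' → δ (g ⊕ one) g' * f g' + δ (g ⊕ ⊖ one) g' * f g') + sum (λ g' → δ (g ⊕ half) g' * f g')
        ≡⟨ cong (_+ sum (λ g' → δ (g ⊕ half) g' * f g'))
                (∑-distrib-+ (λ g' → δ (g ⊕ one) g' * f g') (λ g' → δ (g ⊕ ⊖ one) g' * f g')) ⟩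
      sum (λ g' → δ (g ⊕ one) g' * f g') + sum (λ g' → δ (g ⊕ ⊖ one) g' * f g')
        + sum (λ g' → δ (g ⊕ half) g' * f g')
        ≡⟨ cong₂ _+_ (cong₂ _+_ (∑-δ (g ⊕ one) f) (∑-δ (g ⊕ ⊖ one) f)) (∑-δ (g ⊕ half) f) ⟩
      f (g ⊕ one) + f (g ⊕ ⊖ one) + f (g ⊕ half) ∎
      where
      open ≡-Reasoning
      distrib : ∀ a b c x → (a + b + c) * x ≡ a * x + b * x + c * x
      distrib = solve-∀ ℚ-ring

    -- one ⊕ a and ⊖ one ⊕ a are generators differing by 2; for n ≥ 5 only one = 2 ⊕ ⊖ one fits.
    common-neighbour-±one : ∀ a → Adj Ladder (⊖ one) a → Adj Ladder one a → a ≡ 𝟘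
    common-neighbour-±one a p q = meet (Equivalence.to (Adj⇔ (⊖ one) a) p) (Equivalence.to (Adj⇔ one a) q)
      where
      s≡2+t : ⊖ (⊖ one) ⊕ a ≡ ι 2 ⊕ (⊖ one ⊕ a)
      s≡2+t = begin
        ⊖ (⊖ one) ⊕ a                ≡⟨ cong (_⊕ a) (⁻¹-involutive one) ⟩
        one ⊕ a                      ≡⟨ cong (one ⊕_) (\\-leftDividesˡ one a) ⟨
        one ⊕ (one ⊕ (⊖ one ⊕ a))    ≡⟨ ⊕-assoc one one _ ⟨
        one ⊕ one ⊕ (⊖ one ⊕ a)      ≡⟨ cong (_⊕ (⊖ one ⊕ a)) (ι-+ 1 1) ⟨
        ι 2 ⊕ (⊖ one ⊕ a)            ∎
        where open ≡-Reasoning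
      meet : Generator (⊖ (⊖ one) ⊕ a) → Generator (⊖ one ⊕ a) → a ≡ 𝟘
      meet _ (inj₂ (inj₁ t≡⊖one)) = begin
        a                    ≡⟨ \\-leftDividesˡ one a ⟨
        one ⊕ (⊖ one ⊕ a)    ≡⟨ cong (one ⊕_) t≡⊖one ⟩
        one ⊕ ⊖ one          ≡⟨ inverseʳ one ⟩
        𝟘                    ∎
        where open ≡-Reasoning
      meet gs (inj₁ t≡one) = ⊥-elim (ι-¬generator 3 (≤4⇒≤3+n ℕP.≤-refl) (λ ()) 3≢n
        (subst Generator (trans s≡2+t (trans (cong (ι 2 ⊕_) t≡one) (sym (ι-+ 2 1)))) gs))
      meet gs (inj₂ (inj₂ t≡half)) = ⊥-elim (ι-¬generator (2 ℕ.+ n) ℕP.≤-refl (λ ()) 2+n≢n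
        (subst Generator (trans s≡2+t (trans (cong (ι 2 ⊕_) t≡half) (sym (ι-+ 2 n)))) gs))
        where
        2+n≢n : 2 ℕ.+ n ≢ n
        2+n≢n = ℕP.<⇒≢ (ℕP.m<n+m n (s≤s z≤n)) ∘ sym

-- Circ(2n, {1, n}) □ K₄

module LadderK₄ (n : ℕ) (n-odd : n % 2 ≡ 1) (5≤n : 5 ≤ n) where

  open MöbiusLadder n n-odd
  private
    module ℤ₄ = Modular 4

  G : Graph
  G = propGraph n

  private
    V = Fin (N G)

  cayley : IsCayley G
  cayley = □-cayley Ladder-cayley (K-cayley 4)

  open Cayley cayley using (translation; translation-to-e; inversion; edge-flip; adj-sym)

  comm : ∀ x y → CayleyData._∙_ cayley x y ≡ CayleyData._∙_ cayley y x
  comm (a , b) (a' , b') = cong₂ _,_ (⊕-comm a a') (ℤ₄.⊕-comm b b')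

  adjMul-G : ∀ y (g : Fin m) (h : Fin 4) → adjMul G y (combine g h) ≡
             (sum (λ h' → y (combine g h')) - y (combine g h))
             + (y (combine (g ⊕ one) h) + y (combine (g ⊕ ⊖ one) h) + y (combine (g ⊕ half) h))
  adjMul-G y g h = trans (adjMul-□ {Ladder} {K 4} Ladder-loopless y g h)
    (cong₂ _+_ (adjMul-K (λ h' → y (combine g h')) h) (adjMul-Ladder 5≤n (λ g' → y (combine g' h)) g))

  alternating : V → ℚ
  alternating x = sign (toℕ (proj₁ (remQuot {m} 4 x)))

  alternating-combine : ∀ (g : Fin m) (h : Fin 4) → alternating (combine g h) ≡ sign (toℕ g)
  alternating-combine g h = cong (sign ∘ toℕ ∘ proj₁) (remQuot-combine g h)

  alternating-null : InNullSpace G alternating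
  alternating-null = combine-elim {Ladder} {K 4} (λ x → adjMul G alternating x ≡ 0ℚ) null
    where
    null : ∀ (g : Fin m) (h : Fin 4) → adjMul G alternating (combine g h) ≡ 0ℚ
    null g h = begin
      adjMul G alternating (combine g h)
        ≡⟨ adjMul-G alternating g h ⟩
      (sum (λ h' → alternating (combine g h')) - alternating (combine g h))
        + (alternating (combine (g ⊕ one) h) + alternating (combine (g ⊕ ⊖ one) h)
           + alternating (combine (g ⊕ half) h))
        ≡⟨ cong₂ _+_ (cong₂ _-_ (sum-cong-≗ (λ h' → alternating-combine g h')) (alternating-combine g h))
                     (cong₂ _+_ (cong₂ _+_ (flip (inj₁ refl)) (flip (inj₂ (inj₁ refl)))) (flip (inj₂ (inj₂ refl)))) ⟩
      (sum {4} (λ _ → sign (toℕ g)) - sign (toℕ g)) + (- sign (toℕ g) + - sign (toℕ g) + - sign (toℕ g))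
        ≡⟨ cancel (sign (toℕ g)) ⟩
      0ℚ ∎
      where
      open ≡-Reasoning
      flip : ∀ {s} → Generator s → alternating (combine (g ⊕ s) h) ≡ - sign (toℕ g)
      flip gen = trans (alternating-combine (g ⊕ _) h) (Adj-sign g _ (Adj-step g gen))
      cancel : ∀ x → (x + (x + (x + (x + 0ℚ))) - x) + (- x + - x + - x) ≡ 0ℚ
      cancel = solve-∀ ℚ-ring

  x₀ : V
  x₀ = combine 𝟘 Fin.zero

  null-unique : ∀ y → InNullSpace G y → ∀ x → y x ≡ y x₀ * alternating x
  null-unique y null = combine-elim {Ladder} {K 4} (λ x → y x ≡ y x₀ * alternating x) λ g h → begin
    y (combine g h)                  ≡⟨ layers-agree h g ⟩
    z g                              ≡⟨ möbiusEq[3]⇒alternating {z} z-eq g ⟩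
    sign (toℕ g) * z 𝟘               ≡⟨ ℚP.*-comm (sign (toℕ g)) (z 𝟘) ⟩
    z 𝟘 * sign (toℕ g)               ≡⟨ cong (z 𝟘 *_) (alternating-combine g h) ⟨
    y x₀ * alternating (combine g h) ∎
    where
    open ≡-Reasoning
    layer : Fin 4 → Fin m → ℚ
    layer h g = y (combine g h)
    z : Fin m → ℚ
    z = layer Fin.zero
    kernel : ∀ h g → (sum (λ h' → layer h' g) - layer h g)
                     + (layer h (g ⊕ one) + layer h (g ⊕ ⊖ one) + layer h (g ⊕ half)) ≡ 0ℚ
    kernel h g = trans (sym (adjMul-G y g h)) (null (combine g h))
    difference : ∀ T a a₁ a₂ a₃ b b₁ b₂ b₃ →
                 (a₁ - b₁) + (a₂ - b₂) + (a₃ - b₃) + - 1ℚ * (a - b) ≡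
                 ((T - a) + (a₁ + a₂ + a₃)) - ((T - b) + (b₁ + b₂ + b₃))
    difference = solve-∀ ℚ-ring
    layers-agree : ∀ h g → layer h g ≡ z g
    layers-agree h g = trans (x+y≡0⇒x≡-y (layer h g) (- z g) (möbiusEq[-1]⇒zero {λ g → layer h g - z g} d-eq g))
                             (neg-involutive (z g))
      where
      d-eq : MöbiusEq (- 1ℚ) (λ g → layer h g - z g)
      d-eq g = trans (difference (sum (λ h' → layer h' g))
                                 (layer h g) (layer h (g ⊕ one)) (layer h (g ⊕ ⊖ one)) (layer h (g ⊕ half))
                                 (z g) (z (g ⊕ one)) (z (g ⊕ ⊖ one)) (z (g ⊕ half)))
                     (trans (cong₂ _-_ (kernel h g) (kernel Fin.zero g)) (ℚP.+-inverseʳ 0ℚ))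
    three : ∀ x a₁ a₂ a₃ → a₁ + a₂ + a₃ + (1ℚ + 1ℚ + 1ℚ) * x ≡
                           (x + (x + (x + (x + 0ℚ))) - x) + (a₁ + a₂ + a₃)
    three = solve-∀ ℚ-ring
    z-eq : MöbiusEq (1ℚ + 1ℚ + 1ℚ) z
    z-eq g = trans (three (z g) (z (g ⊕ one)) (z (g ⊕ ⊖ one)) (z (g ⊕ half)))
      (trans (cong (λ t → (t - z g) + (z (g ⊕ one) + z (g ⊕ ⊖ one) + z (g ⊕ half)))
                   (sym (sum-cong-≗ {4} (λ h → layers-agree h g))))
             (kernel Fin.zero g))

  nut : IsNut G
  nut = ℕP.≤-trans 1<m (ℕP.m≤m*n m 4)
      , alternating
      , (λ x → sign≢0 (toℕ (proj₁ (remQuot {m} 4 x))))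
      , alternating-null
      , λ y null → y x₀ , null-unique y null

  σ-inversion : ∀ a b → σ (inversion comm) (combine a b) ≡ combine (⊖ a) (ℤ₄.⊖ b)
  σ-inversion a b = cong (λ p → combine (⊖ proj₁ p) (ℤ₄.⊖ proj₂ p)) (remQuot-combine a b)

  -- x₀ y₁ is a rim edge, x₀ yₙ a rung and x₀ z₁ an edge of the K₄ factor.
  y₁ yₙ z₁ : V
  y₁ = combine one Fin.zero
  yₙ = combine half Fin.zero
  z₁ = combine 𝟘 (Fin.suc Fin.zero)

  Adj-𝟘 : ∀ {s} → Generator s → Adj Ladder 𝟘 s
  Adj-𝟘 {s} gen = subst (Adj Ladder 𝟘) (⊕-identityˡ s) (Adj-step 𝟘 gen)

  Adj-𝟘⁻ : ∀ s → Adj Ladder 𝟘 s → Generator s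
  Adj-𝟘⁻ s p = subst Generator (trans (cong (_⊕ s) ε⁻¹≈ε) (⊕-identityˡ s)) (Equivalence.to (Adj⇔ 𝟘 s) p)

  ladder-edge : ∀ {s} → Generator s → Adj G x₀ (combine s Fin.zero)
  ladder-edge gen = Adj-□ᴳ {Ladder} {K 4} Fin.zero (Adj-𝟘 gen)

  ladder-edge-triangle-free : ∀ {s} → Generator s → ¬ InTriangle {G} x₀ (combine s Fin.zero)
  ladder-edge-triangle-free {s} gen t =
    Ladder-triangle-free 𝟘 s (Adj-𝟘 gen)
      (□-triangleᴳ {Ladder} {K 4} K-loopless Ladder-loopless Fin.zero (Adj-𝟘 gen) t)

  z₁-triangle : InTriangle {G} x₀ z₁
  z₁-triangle = □-triangleᴴ {Ladder} {K 4} 𝟘 (K-triangle (λ ()))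

  G-sym : ∀ u v → Adj G u v → Adj G v u
  G-sym u v p = trans (adj-sym v u) p

  yₙ-squares : ClosesSquares {G} x₀ yₙ
  yₙ-squares = combine-elim {Ladder} {K 4}
    (λ a → Adj G x₀ a → ¬ InTriangle {G} x₀ a → a ≢ yₙ → ∃[ b ] Adj G a b × Adj G b yₙ × b ≢ x₀)
    square
    where
    square : ∀ a₁ a₂ → Adj G x₀ (combine a₁ a₂) → ¬ InTriangle {G} x₀ (combine a₁ a₂) → combine a₁ a₂ ≢ yₙ →
             ∃[ b ] Adj G (combine a₁ a₂) b × Adj G b yₙ × b ≢ x₀
    square a₁ a₂ p ¬t a≢yₙ with Equivalence.to (Adj-□⇔ {Ladder} {K 4} {𝟘} {Fin.zero} {a₁} {a₂}) p
    ... | inj₁ (refl , 0a₂) = ⊥-elim (¬t (□-triangleᴴ {Ladder} {K 4} 𝟘 (K-triangle (Adj-K⇒≢ 0a₂))))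
    ... | inj₂ (refl , 𝟘a₁) =
          combine (a₁ ⊕ half) Fin.zero
        , Adj-□ᴳ {Ladder} {K 4} Fin.zero (Adj-step a₁ (inj₂ (inj₂ refl)))
        , Adj-□ᴳ {Ladder} {K 4} Fin.zero
                 (Ladder-sym half _ (subst (Adj Ladder half) (⊕-comm half a₁) (Adj-step half (Adj-𝟘⁻ a₁ 𝟘a₁))))
        , λ e → a≢yₙ (cong (λ c → combine c Fin.zero)
                           (trans (inverseˡ-unique a₁ half (proj₁ (FinP.combine-injective _ _ _ _ e))) ⊖half))

  y₁-¬squares : ¬ ClosesSquares {G} x₀ y₁
  y₁-¬squares squares =
    let b , ab , by₁ , b≢x₀ = squares (combine (⊖ one) Fin.zero) (ladder-edge (inj₂ (inj₁ refl)))
                                      (ladder-edge-triangle-free (inj₂ (inj₁ refl)))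
                                      (λ e → one≢⊖one 5≤n (sym (proj₁ (FinP.combine-injective _ _ _ _ e))))
        c , b≡c0 , ⊖one~c , one~c = □-common-neighbour {Ladder} {K 4} K-loopless (one≢⊖one 5≤n ∘ sym) b ab
                                                        (G-sym b y₁ by₁)
    in b≢x₀ (trans b≡c0 (cong (λ c → combine c Fin.zero) (common-neighbour-±one 5≤n c ⊖one~c one~c)))

  arc : Fin 3 → Arc G
  arc 0F = (x₀ , y₁) , ladder-edge (inj₁ refl)
  arc 1F = (x₀ , yₙ) , ladder-edge (inj₂ (inj₂ refl))
  arc 2F = (x₀ , z₁) , Adj-□ᴴ {Ladder} {K 4} 𝟘 refl

  to-x₀ : ∀ x → ∃[ φ ] σ φ x ≡ x₀
  to-x₀ x = translation (CayleyData._⁻¹ cayley (CayleyData.f cayley x)) , translation-to-e x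

  at-x₀ : ∀ y (p : Adj G x₀ y) → ∃[ i ] SameArcOrbit G ((x₀ , y) , p) (arc i)
  at-x₀ = combine-elim {Ladder} {K 4} (λ y → (p : Adj G x₀ y) → ∃[ i ] SameArcOrbit G ((x₀ , y) , p) (arc i))
    λ a b p → classify {p = p} (Equivalence.to (Adj-□⇔ {Ladder} {K 4} {𝟘} {Fin.zero} {a} {b}) p)
    where
    classify : ∀ {a b} {p : Adj G x₀ (combine a b)} →
               (𝟘 ≡ a × Adj (K 4) Fin.zero b) ⊎ (Fin.zero ≡ b × Adj Ladder 𝟘 a) →
               ∃[ i ] SameArcOrbit G ((x₀ , combine a b) , p) (arc i)
    classify {b = b} (inj₁ (refl , 0b)) =
        2F , □-aut (idᴬ {Ladder}) swap
      , trans (σ-□-aut (idᴬ {Ladder}) swap 𝟘 0F)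
              (cong (combine 𝟘) (transpose-fixes {i = b} {1F} (Adj-K⇒≢ 0b) (λ ())))
      , trans (σ-□-aut (idᴬ {Ladder}) swap 𝟘 b) (cong (combine 𝟘) (transpose-maps {i = b} {1F}))
      where
      swap : Aut (K 4)
      swap = K-aut (transpose b 1F)
    classify {a = a} (inj₂ (refl , 𝟘a)) with Adj-𝟘⁻ a 𝟘a
    ... | inj₁ refl        = 0F , idᴬ {G} , refl , refl
    ... | inj₂ (inj₂ refl) = 1F , idᴬ {G} , refl , refl
    ... | inj₂ (inj₁ refl) = 0F , inversion comm
                           , trans (σ-inversion 𝟘 0F) (cong (λ c → combine c 0F) ε⁻¹≈ε)
                           , trans (σ-inversion (⊖ one) 0F) (cong (λ c → combine c 0F) (⁻¹-involutive one))

  private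
    squares-⇔ : ∀ (φ : Aut G) {u v u' v'} → σ φ u ≡ u' → σ φ v ≡ v' →
                ClosesSquares {G} u v ⇔ ClosesSquares {G} u' v'
    squares-⇔ = invariant-⇔ (ClosesSquares-invariant {G})

    triangle-⇔ : ∀ (φ : Aut G) {u v u' v'} → σ φ u ≡ u' → σ φ v ≡ v' →
                 InTriangle {G} u v ⇔ InTriangle {G} u' v'
    triangle-⇔ = invariant-⇔ (InTriangle-invariant {G})

    y₁-triangle-free : ¬ InTriangle {G} x₀ y₁
    y₁-triangle-free = ladder-edge-triangle-free (inj₁ refl)

    yₙ-triangle-free : ¬ InTriangle {G} x₀ yₙ
    yₙ-triangle-free = ladder-edge-triangle-free (inj₂ (inj₂ refl))

  distinct : ∀ i j → SameArcOrbit G (arc i) (arc j) → i ≡ j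
  distinct 0F 0F _ = refl
  distinct 1F 1F _ = refl
  distinct 2F 2F _ = refl
  distinct 0F 1F (φ , e₁ , e₂) = ⊥-elim (y₁-¬squares (Equivalence.from (squares-⇔ φ e₁ e₂) yₙ-squares))
  distinct 1F 0F (φ , e₁ , e₂) = ⊥-elim (y₁-¬squares (Equivalence.to (squares-⇔ φ e₁ e₂) yₙ-squares))
  distinct 0F 2F (φ , e₁ , e₂) = ⊥-elim (y₁-triangle-free (Equivalence.from (triangle-⇔ φ e₁ e₂) z₁-triangle))
  distinct 2F 0F (φ , e₁ , e₂) = ⊥-elim (y₁-triangle-free (Equivalence.to (triangle-⇔ φ e₁ e₂) z₁-triangle))
  distinct 1F 2F (φ , e₁ , e₂) = ⊥-elim (yₙ-triangle-free (Equivalence.from (triangle-⇔ φ e₁ e₂) z₁-triangle))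
  distinct 2F 1F (φ , e₁ , e₂) = ⊥-elim (yₙ-triangle-free (Equivalence.to (triangle-⇔ φ e₁ e₂) z₁-triangle))

  arcOrbits : ArcOrbits G 3
  arcOrbits = arc , distinct , arc-cover arc x₀ to-x₀ at-x₀

  edgeOrbits : EdgeOrbits G 3
  edgeOrbits = arcOrbits⇒edgeOrbits (λ u v _ → edge-flip comm u v) arcOrbits

proposition3 : (n : ℕ) → n % 2 ≡ 1 → 5 ≤ n →
    IsCayley (propGraph n) × IsNut (propGraph n) ×
    EdgeOrbits (propGraph n) 3 × ArcOrbits (propGraph n) 3
proposition3 n n-odd 5≤n = cayley , nut , edgeOrbits , arcOrbits
  where open LadderK₄ n n-odd 5≤n
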